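{- Let $n\ge1$ and let $\nabla$ be the linear operator on $\mathbf{Sym}_n$ (over the field of rational functions in $q_1,\dots,q_{n-1},t_1,\dots,t_{n-1}$) defined by $\nabla\tilde H_I=\bigl(\prod_{d=1}^{n-1}z_d(I)\bigr)\tilde H_I$. Then $$\nabla\Lambda_n=\sum_{w\in \mathrm{PW}_n}\frac{\phi(w)}{d_{C(\sigma_w^{ -1})}}\,R_{C(\sigma_w^{ -1})}.$$
   Context: $R_J$ denotes the ribbon basis of noncommutative symmetric functions, $\Lambda_n=R_{(1^n)}$. For a composition $I$ of $n$ with descent set $\mathrm{Des}(I)$ (partial sums of its parts, excluding $n$), set $z_k(I)=t_{n-k}$ if $k\in\mathrm{Des}(I)$ and $z_k(I)=q_k$ otherwise ($1\le k\le n-1$), and $\tilde H_I=\sum_{J\vDash n}\bigl(\prod_{d\in\mathrm{Des}(J)}z_d(I)\bigr)R_J$ (multiparameter Bergeron–Zabrocki functions; they form a basis). A packed word of length $n$ is a word $w$ over positive integers such that whenever $i>1$ occurs in $w$, $i-1$ also occurs; $\mathrm{PW}_n$ is their set. For a word $w$, $\overline w$ denotes its mirror image (reversal), $\mathrm{std}$ the standardization, and $\sigma_w=\overline{\mathrm{std}(\overline w)}$, a permutation. For a permutation $\sigma$, $C(\sigma)$ is its descent composition, and $d_I$ is the number of permutations $\sigma$ of $n$ with $C(\sigma)=I$. With $w^\uparrow$ the nondecreasing rearrangement of $w$, $\phi(w)=\prod_{i\in\mathrm{Des}(\sigma_w^{ -1})}x_i$ where $x_i=q_i$ if $w^\uparrow_i=w^\uparrow_{i+1}$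 and $x_i=t_{n-i}$ otherwise. -}

module Defs where

open import Level using (_⊔_)
open import Data.Bool using (Bool; true; false; if_then_else_; _∧_; _∨_; not)
open import Data.Nat using (ℕ; zero; suc; _+_; _∸_; _<_; _≤_; _<ᵇ_; _≡ᵇ_; _≤ᵇ_; pred)
open import Data.Nat.Properties using (_≟_)
open import Data.Nat.ListAction using (sum)
open import Data.Bool.ListAction using (all; any)
open import Data.List using (List; []; _∷_; map; filter; length; reverse; applyUpTo; concatMap; replicate; foldr)
open import Data.List.Properties using (≡-dec)
open import Data.List.Relation.Unary.All using (All)
open import Data.Product using (Σ; _×_; _,_; proj₁; proj₂; ∃)
open import Relation.Nullary using (¬_; does)
open import Relation.Binary.PropositionalEquality using (_≡_)
open import Algebra.Bundles using (CommutativeRing)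

-- Combinatorics on words / permutations / compositions (pure ℕ lists)
-- All positions are 1-based, as in the paper.

_==ᴸ_ : List ℕ → List ℕ → Bool
u ==ᴸ v = does (≡-dec _≟_ u v)

_∈ᵇ_ : ℕ → List ℕ → Bool
x ∈ᵇ u = any (x ≡ᵇ_) u

range1 : ℕ → List ℕ
range1 k = applyUpTo suc k

words : ℕ → ℕ → List (List ℕ)
words zero    k = [] ∷ []
words (suc l) k = concatMap (λ a → map (a ∷_) (words l k)) (range1 k)

isPacked : List ℕ → Bool
isPacked w = all (λ i → not (i ≡ᵇ 0) ∧ ((i ≡ᵇ 1) ∨ (pred i ∈ᵇ w))) w

-- PW_n : packed words of length n.  (A packed word of length n only uses
-- letters ≤ n, so these are all of them, each listed once.)
PW : ℕ → List (List ℕ)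
PW n = filter (λ w → isPacked w Data.Bool.≟ true) (words n n)

isPerm : ℕ → List ℕ → Bool
isPerm n w = all (λ k → k ∈ᵇ w) (range1 n)

Perms : ℕ → List (List ℕ)
Perms n = filter (λ w → isPerm n w Data.Bool.≟ true) (words n n)

-- i-th letter (1-based), 0 if out of range
at : List ℕ → ℕ → ℕ
at []      _             = 0
at (x ∷ u) zero          = 0
at (x ∷ u) (suc zero)    = x
at (x ∷ u) (suc (suc i)) = at u (suc i)

count : (ℕ → Bool) → List ℕ → ℕ
count p u = length (filter (λ x → p x Data.Bool.≟ true) u)

-- standardization: std(u)_j = #{k : u_k < u_j} + #{k < j : u_k = u_j} + 1
stdAux : List ℕ → List ℕ → List ℕ
stdAux u-all []      = []
stdAux u-all (x ∷ r) = suc (count (_<ᵇ x) u-all + count (x ≡ᵇ_) r) ∷ stdAux u-all r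

-- stdAux is run on the reversed word, so the suffix r consists exactly of
-- the letters to the LEFT of x in u, giving #{k < j : u_k = u_j}.
std : List ℕ → List ℕ
std u = reverse (stdAux u (reverse u))

σ : List ℕ → List ℕ
σ w = reverse (std (reverse w))

-- position (1-based) of v in u, 0 if absent
posOf : ℕ → List ℕ → ℕ
posOf v []      = 0
posOf v (x ∷ u) = if v ≡ᵇ x then 1 else (if v ∈ᵇ u then suc (posOf v u) else 0)

invPerm : List ℕ → List ℕ
invPerm s = map (λ v → posOf v s) (range1 (length s))

Des-word : List ℕ → List ℕ
Des-word u = filter (λ i → (at u (suc i) <ᵇ at u i) Data.Bool.≟ true) (range1 (length u ∸ 1))

-- descent composition of a permutation: lengths of maximal increasing runs
runsAux : ℕ → ℕ → List ℕ → List ℕ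
runsAux prev k []      = k ∷ []
runsAux prev k (y ∷ r) = if prev <ᵇ y then runsAux y (suc k) r else k ∷ runsAux y 1 r

C : List ℕ → List ℕ
C []      = []
C (x ∷ r) = runsAux x 1 r

IsComposition : ℕ → List ℕ → Set
IsComposition n I = All (λ a → 0 < a) I × sum I ≡ n

Comp : ℕ → Set
Comp n = Σ (List ℕ) (IsComposition n)

partials : ℕ → List ℕ → List ℕ
partials acc []          = []
partials acc (a ∷ [])    = []
partials acc (a ∷ b ∷ r) = (acc + a) ∷ partials (acc + a) (b ∷ r)

Des : List ℕ → List ℕ
Des I = partials 0 I

dcount : ℕ → List ℕ → ℕ
dcount n I = length (filter (λ s → (C s ==ᴸ I) Data.Bool.≟ true) (Perms n))

insert : ℕ → List ℕ → List ℕ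
insert x []      = x ∷ []
insert x (y ∷ u) = if x ≤ᵇ y then x ∷ y ∷ u else y ∷ insert x u

sortUp : List ℕ → List ℕ
sortUp = foldr insert []

module OverRing {c ℓ} (K : CommutativeRing c ℓ) where
  open CommutativeRing K renaming (_+_ to _+K_; _*_ to _*K_)

  ℕ→K : ℕ → Carrier
  ℕ→K zero    = 0#
  ℕ→K (suc m) = 1# +K ℕ→K m

  prodK : List Carrier → Carrier
  prodK = foldr _*K_ 1#

  sumK : List Carrier → Carrier
  sumK = foldr _+K_ 0#

  -- K is a field of characteristic 0, with ι m the inverse of m (m ≥ 1)
  IsCharZeroField : (ℕ → Carrier) → Set (c ⊔ ℓ)
  IsCharZeroField ι =
    (¬ (1# ≈ 0#)) ×
    ((x : Carrier) → ¬ (x ≈ 0#) → ∃ λ y → x *K y ≈ 1#) ×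
    ((m : ℕ) → ℕ→K (suc m) *K ι (suc m) ≈ 1#)

  -- Sym_n, as coefficient vectors in the ribbon basis (R_J ↦ coefficient)
  Sym : ℕ → Set c
  Sym n = Comp n → Carrier

  _≋_ : {n : ℕ} → Sym n → Sym n → Set ℓ
  f ≋ g = ∀ J → f J ≈ g J

  _⊕_ : {n : ℕ} → Sym n → Sym n → Sym n
  (f ⊕ g) J = f J +K g J

  _⊙_ : {n : ℕ} → Carrier → Sym n → Sym n
  (a ⊙ f) J = a *K f J

  R : (n : ℕ) → List ℕ → Sym n
  R n I J = if I ==ᴸ proj₁ J then 1# else 0#

  Λ : (n : ℕ) → Sym n
  Λ n = R n (replicate n 1)

  module Params (n : ℕ) (q t : ℕ → Carrier) where
    z : ℕ → List ℕ → Carrier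
    z k I = if k ∈ᵇ Des I then t (n ∸ k) else q k

    H̃ : Comp n → Sym n
    H̃ I J = prodK (map (λ d → z d (proj₁ I)) (Des (proj₁ J)))

    eig : Comp n → Carrier
    eig I = prodK (map (λ d → z d (proj₁ I)) (range1 (n ∸ 1)))

    combH : List (Carrier × Comp n) → Sym n
    combH L J = sumK (map (λ p → proj₁ p *K H̃ (proj₂ p) J) L)

    HSpans : Set (c ⊔ ℓ)
    HSpans = (f : Sym n) → ∃ λ (L : List (Carrier × Comp n)) → f ≋ combH L

    IsLinear : (Sym n → Sym n) → Set (c ⊔ ℓ)
    IsLinear N =
      ((f g : Sym n) → f ≋ g → N f ≋ N g) ×
      ((f g : Sym n) → N (f ⊕ g) ≋ (N f ⊕ N g)) ×
      ((a : Carrier) (f : Sym n) → N (a ⊙ f) ≋ (a ⊙ N f))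

    IsNabla : (Sym n → Sym n) → Set (c ⊔ ℓ)
    IsNabla N = IsLinear N × ((I : Comp n) → N (H̃ I) ≋ (eig I ⊙ H̃ I))

    φ : List ℕ → Carrier
    φ w = prodK (map x (Des-word (invPerm (σ w))))
      where
        x : ℕ → Carrier
        x i = if at (sortUp w) i ≡ᵇ at (sortUp w) (suc i) then q i else t (n ∸ i)

    RHS : (ι : ℕ → Carrier) → Sym n
    RHS ι J = sumK (map term (PW n))
      where
        term : List ℕ → Carrier
        term w = φ w *K ι (dcount n (C (invPerm (σ w)))) *K R n (C (invPerm (σ w))) J

-- Write Λ_n = Σ_I c_I H̃_I. As ∇ is diagonal on the H̃_I, the coefficient of R_J in ∇Λ_n is
-- Σ_I c_I ∏_d z_d(I)^(e_d) with e_d = 2 for d ∈ Des J and e_d = 1 otherwise. For exponents in {0,1}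
-- the same sum is the coefficient in Λ_n of the ribbon with descents {d : e_d = 1}, namely ∏_d [e_d = 1].
-- Each z_d(I) is q_d or t_(n-d), hence a root of z² = (q_d + t_(n-d)) z − q_d t_(n-d); lowering the
-- exponents 2 one at a time gives ∇Λ_n = Σ_J ∏_(d ∈ Des J) (q_d + t_(n-d)) R_J.
--
-- On the other side, w ↦ (σ_w⁻¹, E_w), where E_w is the set of descents i of σ_w⁻¹ with w↑_i = w↑_(i+1),
-- is a bijection from PW_n onto the pairs (τ, E) with τ ∈ S_n and E ⊆ Des τ; the inverse puts at position j
-- the τ⁻¹(j)-th letter of the nondecreasing packed word whose plateaus start exactly at E. Under it
-- φ(w) = ∏_(i ∈ E) q_i ∏_(i ∈ Des τ ∖ E) t_(n-i), so summing over E gives ∏_(i ∈ Des τ) (q_i + t_(n-i)),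
-- which only depends on C(τ); the d_J permutations with C(τ) = J cancel the factor 1/d_J.

module Submission where

open import Defs
open import Level using (Level)
open import Data.Nat using (ℕ; _≤_; suc)
open import Data.Product using (_,_; proj₁)
open import Algebra.Bundles using (CommutativeRing)

module Combinatorics where

  open import Data.Bool using (Bool; true; false; if_then_else_; _∧_; _∨_; not; T)
  open import Data.Bool.ListAction using (all; and)
  open import Data.Empty using (⊥; ⊥-elim)
  open import Data.List using (List; []; _∷_; map; filter; length; applyUpTo; replicate; _++_; drop; reverse; concatMap)
  open import Data.List.Membership.Propositional using (_∈_; _∉_; find)
  open import Data.List.Membership.Propositional.Properties using (∈-∃++; ∈-++⁺ˡ; ∈-++⁺ʳ; ∈-++⁻; ∈-map⁺; ∈-map⁻; ∈-filter⁺; ∈-filter⁻; ∈-concatMap⁺; ∈-concatMap⁻)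
  open import Data.List.Properties using (length-++; length-map; drop-map; reverse-involutive; ∷-injectiveʳ; ∷-injectiveˡ; ≡-dec)
  open import Data.List.Relation.Binary.Permutation.Propositional using (_↭_; prep; swap; ↭-sym; ↭-trans; ↭-refl)
  import Data.List.Relation.Binary.Permutation.Propositional as Perm
  open import Data.List.Relation.Binary.Permutation.Propositional.Properties using (∈-resp-↭; All-resp-↭; shift; filter-↭; ↭-length; map⁺; ↭-reverse; ↭-empty-inv; drop-∷)
  open import Data.List.Relation.Unary.All as All using (All; []; _∷_)
  import Data.List.Relation.Unary.All.Properties as AllP
  open AllP using (All¬⇒¬Any; ¬Any⇒All¬)
  open import Data.List.Relation.Unary.AllPairs using ([]; _∷_)
  open import Data.List.Relation.Unary.Any as Any using (Any; here; there)
  open import Data.List.Relation.Unary.Unique.Propositional using (Unique)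
  import Data.List.Relation.Unary.Unique.Propositional.Properties as UP
  open import Data.Nat
  open import Data.Nat.ListAction using (sum)
  open import Data.Nat.Properties
  open import Data.Product using (Σ; _×_; _,_; proj₁; proj₂; uncurry)
  open import Data.Product.Properties using (,-injectiveʳ; ,-injectiveˡ)
  open import Data.Sum using (_⊎_; inj₁; inj₂)
  open import Data.Unit using (⊤; tt)
  open import Function using (_∘_)
  open import Relation.Binary.Definitions using (Tri; tri<; tri≈; tri>)
  open import Relation.Binary.PropositionalEquality
  open import Relation.Nullary using (¬_; yes; no)
  open import Relation.Nullary.Decidable using (dec-true; dec-false)

  ≡ᵇ-refl : ∀ a → (a ≡ᵇ a) ≡ true
  ≡ᵇ-refl zero = refl
  ≡ᵇ-refl (suc a) = ≡ᵇ-refl a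

  ≡ᵇ-true⇒≡ : ∀ a b → (a ≡ᵇ b) ≡ true → a ≡ b
  ≡ᵇ-true⇒≡ a b e = ≡ᵇ⇒≡ a b (subst T (sym e) tt)

  ≢⇒≡ᵇ-false : ∀ a b → a ≢ b → (a ≡ᵇ b) ≡ false
  ≢⇒≡ᵇ-false a b ne with a ≡ᵇ b in eq
  ... | false = refl
  ... | true = ⊥-elim (ne (≡ᵇ-true⇒≡ a b eq))

  ≡⇒≡ᵇ-true : ∀ {m n} → m ≡ n → (m ≡ᵇ n) ≡ true
  ≡⇒≡ᵇ-true {m} refl = ≡ᵇ-refl m

  ≡ᵇ-false⇒≢ : ∀ {m n} → (m ≡ᵇ n) ≡ false → m ≢ n
  ≡ᵇ-false⇒≢ {m} e refl rewrite ≡ᵇ-refl m with e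
  ... | ()

  <⇒<ᵇ-true : ∀ {m n} → m < n → (m <ᵇ n) ≡ true
  <⇒<ᵇ-true {m} {n} p with m <ᵇ n | <⇒<ᵇ p
  ... | true | _ = refl

  <ᵇ-true⇒< : ∀ {m n} → (m <ᵇ n) ≡ true → m < n
  <ᵇ-true⇒< {m} {n} e = <ᵇ⇒< m n (subst T (sym e) tt)

  ≥⇒<ᵇ-false : ∀ {m n} → n ≤ m → (m <ᵇ n) ≡ false
  ≥⇒<ᵇ-false {m} {n} p with m <ᵇ n in e
  ... | false = refl
  ... | true = ⊥-elim (<⇒≱ (<ᵇ-true⇒< e) p)

  true≢false : true ≢ false
  true≢false ()

  ==ᴸ-true⇒≡ : ∀ u v → (u ==ᴸ v) ≡ true → u ≡ v
  ==ᴸ-true⇒≡ u v e with ≡-dec _≟_ u v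
  ... | yes u≡v = u≡v
  ==ᴸ-true⇒≡ u v () | no _

  interval : ℕ → ℕ → List ℕ
  interval a zero = []
  interval a (suc k) = a ∷ interval (suc a) k

  applyUpTo≡interval : ∀ (f : ℕ → ℕ) a k → (∀ i → f i ≡ a + i) → applyUpTo f k ≡ interval a k
  applyUpTo≡interval f a zero h = refl
  applyUpTo≡interval f a (suc k) h =
    cong₂ _∷_ (trans (h 0) (+-identityʳ a))
              (applyUpTo≡interval (f ∘ suc) (suc a) k (λ i → trans (h (suc i)) (+-suc a i)))

  range1≡interval : ∀ k → range1 k ≡ interval 1 k
  range1≡interval k = applyUpTo≡interval suc 1 k (λ i → refl)

  length-interval : ∀ a k → length (interval a k) ≡ k
  length-interval a zero = refl
  length-interval a (suc k) = cong suc (length-interval (suc a) k)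

  ∈-interval⁻ : ∀ {a k x} → x ∈ interval a k → a ≤ x × x < a + k
  ∈-interval⁻ {a} {suc k} (here refl) = ≤-refl , m<m+n a (s≤s z≤n)
  ∈-interval⁻ {a} {suc k} {x} (there m) with ∈-interval⁻ {suc a} {k} m
  ... | l , u = ≤-trans (n≤1+n a) l , subst (x <_) (sym (+-suc a k)) u

  ∈-interval⁺ : ∀ {a k x} → a ≤ x → x < a + k → x ∈ interval a k
  ∈-interval⁺ {a} {zero} {x} l u = ⊥-elim (<-irrefl refl (<-≤-trans (subst (x <_) (+-identityʳ a) u) l))
  ∈-interval⁺ {a} {suc k} {x} l u with x ≟ a
  ... | yes refl = here refl
  ... | no ne = there (∈-interval⁺ {suc a} (≤∧≢⇒< l (λ e → ne (sym e))) (subst (x <_) (+-suc a k) u))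

  interval-unique : ∀ a k → Unique (interval a k)
  interval-unique a zero = []
  interval-unique a (suc k) = ¬Any⇒All¬ _ (λ m → <-irrefl refl (proj₁ (∈-interval⁻ {suc a} {k} m))) ∷ interval-unique (suc a) k

  map-cong-interval : ∀ {A : Set} (f g : ℕ → A) a k → (∀ i → a ≤ i → i < a + k → f i ≡ g i) → map f (interval a k) ≡ map g (interval a k)
  map-cong-interval f g a zero h = refl
  map-cong-interval f g a (suc k) h = cong₂ _∷_ (h a ≤-refl (m<m+n a (s≤s z≤n)))
    (map-cong-interval f g (suc a) k (λ i l u → h i (≤-trans (n≤1+n a) l) (subst (i <_) (sym (+-suc a k)) u)))

  map-interval-suc : ∀ {A : Set} (f : ℕ → A) a k → map f (interval (suc a) k) ≡ map (f ∘ suc) (interval a k)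
  map-interval-suc f a zero = refl
  map-interval-suc f a (suc k) = cong (f (suc a) ∷_) (map-interval-suc f (suc a) k)

  interval-++ : ∀ a j k → interval a (j + k) ≡ interval a j ++ interval (a + j) k
  interval-++ a zero k = cong (λ b → interval b k) (sym (+-identityʳ a))
  interval-++ a (suc j) k = cong (a ∷_) (trans (interval-++ (suc a) j k) (cong (λ b → interval (suc a) j ++ interval b k) (sym (+-suc a j))))

  drop-interval : ∀ a k j → drop j (interval a k) ≡ interval (a + j) (k ∸ j)
  drop-interval a k zero = cong (λ b → interval b k) (sym (+-identityʳ a))
  drop-interval a zero (suc j) = refl
  drop-interval a (suc k) (suc j) = trans (drop-interval (suc a) k j) (cong (λ b → interval b (k ∸ j)) (sym (+-suc a j)))

  at-suc : ∀ x u i → 1 ≤ i → at (x ∷ u) (suc i) ≡ at u i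
  at-suc x u (suc i) _ = refl

  at-map : ∀ (f : ℕ → ℕ) xs i → 1 ≤ i → i ≤ length xs → at (map f xs) i ≡ f (at xs i)
  at-map f (x ∷ xs) (suc zero) _ _ = refl
  at-map f (x ∷ xs) (suc (suc i)) _ (s≤s le) = at-map f xs (suc i) (s≤s z≤n) le

  at-interval : ∀ a k i → i < k → at (interval a k) (suc i) ≡ a + i
  at-interval a (suc k) zero _ = sym (+-identityʳ a)
  at-interval a (suc k) (suc i) (s≤s l) = trans (at-interval (suc a) k i l) (sym (+-suc a i))

  at-interval-from1 : ∀ k i → 1 ≤ i → i ≤ k → at (interval 1 k) i ≡ i
  at-interval-from1 k (suc i) _ l = at-interval 1 k i l

  length-range1 : ∀ k → length (range1 k) ≡ k
  length-range1 k = trans (cong length (range1≡interval k)) (length-interval 1 k)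

  at-range1 : ∀ k i → 1 ≤ i → i ≤ k → at (range1 k) i ≡ i
  at-range1 k i l u = trans (cong (λ r → at r i) (range1≡interval k)) (at-interval-from1 k i l u)

  map-at-interval : ∀ u → u ≡ map (at u) (interval 1 (length u))
  map-at-interval [] = refl
  map-at-interval (x ∷ u) = cong (x ∷_) (trans (map-at-interval u)
    (trans (map-cong-interval (at u) (at (x ∷ u) ∘ suc) 1 (length u) (λ i l _ → sym (at-suc x u i l)))
           (sym (map-interval-suc (at (x ∷ u)) 1 (length u)))))

  at-extensionality : ∀ u v → length u ≡ length v → (∀ i → 1 ≤ i → i ≤ length u → at u i ≡ at v i) → u ≡ v
  at-extensionality u v e h = trans (map-at-interval u) (trans (map-cong-interval (at u) (at v) 1 (length u) (λ i l up → h i l (≤-pred up)))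
    (trans (cong (λ k → map (at v) (interval 1 k)) e) (sym (map-at-interval v))))

  drop-map-at : ∀ u j → drop j u ≡ map (at u) (interval (suc j) (length u ∸ j))
  drop-map-at u j = trans (cong (drop j) (map-at-interval u)) (trans (drop-map j (interval 1 (length u))) (cong (map (at u)) (drop-interval 1 (length u) j)))

  at-∈ : ∀ u i → 1 ≤ i → i ≤ length u → at u i ∈ u
  at-∈ (x ∷ u) (suc zero) _ _ = here refl
  at-∈ (x ∷ u) (suc (suc i)) _ (s≤s l) = there (at-∈ u (suc i) (s≤s z≤n) l)

  ∈-at : ∀ {x} u → x ∈ u → Σ ℕ λ i → 1 ≤ i × i ≤ length u × at u i ≡ x
  ∈-at (y ∷ u) (here refl) = 1 , s≤s z≤n , s≤s z≤n , refl
  ∈-at (y ∷ u) (there m) with ∈-at u m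
  ... | suc i , _ , l , e = suc (suc i) , s≤s z≤n , s≤s l , e

  Unique⇒at-injective : ∀ u → Unique u → ∀ i j → 1 ≤ i → i ≤ length u → 1 ≤ j → j ≤ length u → at u i ≡ at u j → i ≡ j
  Unique⇒at-injective (x ∷ u) (a ∷ un) (suc zero) (suc zero) _ _ _ _ e = refl
  Unique⇒at-injective (x ∷ u) (a ∷ un) (suc zero) (suc (suc j)) _ _ _ (s≤s lj) e =
    ⊥-elim (All¬⇒¬Any a (subst (_∈ u) (sym e) (at-∈ u (suc j) (s≤s z≤n) lj)))
  Unique⇒at-injective (x ∷ u) (a ∷ un) (suc (suc i)) (suc zero) _ (s≤s li) _ _ e =
    ⊥-elim (All¬⇒¬Any a (subst (_∈ u) e (at-∈ u (suc i) (s≤s z≤n) li)))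
  Unique⇒at-injective (x ∷ u) (a ∷ un) (suc (suc i)) (suc (suc j)) _ (s≤s li) _ (s≤s lj) e =
    cong suc (Unique⇒at-injective u un (suc i) (suc j) (s≤s z≤n) li (s≤s z≤n) lj e)

  at-injective⇒Unique : ∀ u → (∀ i j → 1 ≤ i → i ≤ length u → 1 ≤ j → j ≤ length u → at u i ≡ at u j → i ≡ j) → Unique u
  at-injective⇒Unique [] h = []
  at-injective⇒Unique (x ∷ u) h = ¬Any⇒All¬ u x∉ ∷ at-injective⇒Unique u (λ i j li ui lj uj e →
    suc-injective (h (suc i) (suc j) (s≤s z≤n) (s≤s ui) (s≤s z≤n) (s≤s uj) (trans (at-suc x u i li) (trans e (sym (at-suc x u j lj))))))
    where
    x∉ : x ∉ u
    x∉ m with ∈-at u m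
    ... | i , li , ui , e with h 1 (suc i) (s≤s z≤n) (s≤s z≤n) (s≤s z≤n) (s≤s ui) (trans (sym e) (sym (at-suc x u i li)))
    ...   | eq = ⊥-elim (1+n≰n (subst (1 ≤_) (sym (suc-injective eq)) li))

  all-at : ∀ {P : ℕ → Set} u → (∀ i → 1 ≤ i → i ≤ length u → P (at u i)) → All P u
  all-at [] h = []
  all-at {P} (x ∷ u) h = h 1 (s≤s z≤n) (s≤s z≤n) ∷ all-at u (λ i l up → subst P (at-suc x u i l) (h (suc i) (s≤s z≤n) (s≤s up)))

  Unique-resp-↭ : ∀ {A : Set} {xs ys : List A} → xs ↭ ys → Unique xs → Unique ys
  Unique-resp-↭ Perm.refl u = u
  Unique-resp-↭ (prep x p) (a ∷ u) = All-resp-↭ p a ∷ Unique-resp-↭ p u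
  Unique-resp-↭ (swap x y p) ((x≢y ∷ ax) ∷ (ay ∷ u)) =
    ((λ e → x≢y (sym e)) ∷ All-resp-↭ p ay) ∷ (All-resp-↭ p ax ∷ Unique-resp-↭ p u)
  Unique-resp-↭ (Perm.trans p q) u = Unique-resp-↭ q (Unique-resp-↭ p u)

  Unique-middle⁻ : ∀ {A : Set} {x : A} ys zs → Unique (ys ++ x ∷ zs) → x ∉ (ys ++ zs) × Unique (ys ++ zs)
  Unique-middle⁻ {x = x} ys zs u with Unique-resp-↭ (shift x ys zs) u
  ... | a ∷ u' = All¬⇒¬Any a , u'

  Unique-middle⁺ : ∀ {A : Set} {x : A} ys zs → x ∉ (ys ++ zs) → Unique (ys ++ zs) → Unique (ys ++ x ∷ zs)
  Unique-middle⁺ {x = x} ys zs x∉ u = Unique-resp-↭ (↭-sym (shift x ys zs)) (¬Any⇒All¬ _ x∉ ∷ u)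

  ∈-middle⁻ : ∀ {A : Set} {x z : A} ys zs → z ∈ ys ++ x ∷ zs → z ≢ x → z ∈ ys ++ zs
  ∈-middle⁻ {x = x} ys zs m ne with ∈-resp-↭ (shift x ys zs) m
  ... | here e = ⊥-elim (ne e)
  ... | there m' = m'

  ∈-middle⁺ : ∀ {A : Set} {x z : A} ys zs → z ∈ ys ++ zs → z ∈ ys ++ x ∷ zs
  ∈-middle⁺ {x = x} ys zs m = ∈-resp-↭ (↭-sym (shift x ys zs)) (there m)

  Unique-sameElements⇒↭ : ∀ {A : Set} {xs ys : List A} → Unique xs → Unique ys →
    (∀ z → z ∈ xs → z ∈ ys) → (∀ z → z ∈ ys → z ∈ xs) → xs ↭ ys
  Unique-sameElements⇒↭ {xs = []} {[]} _ _ _ _ = ↭-refl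
  Unique-sameElements⇒↭ {xs = []} {y ∷ ys} _ _ _ b with b y (here refl)
  ... | ()
  Unique-sameElements⇒↭ {xs = x ∷ xs} {ys} (ax ∷ ux) uy f b with ∈-∃++ (f x (here refl))
  ... | ys1 , ys2 , refl =
    ↭-trans (prep x (Unique-sameElements⇒↭ ux (proj₂ (Unique-middle⁻ ys1 ys2 uy))
      (λ z m → ∈-middle⁻ ys1 ys2 (f z (there m)) (λ e → All¬⇒¬Any ax (subst (_∈ xs) e m)))
      (λ z m → ⊆xs z m)))
      (↭-sym (shift x ys1 ys2))
    where
    ⊆xs : ∀ z → z ∈ ys1 ++ ys2 → z ∈ xs
    ⊆xs z m with b z (∈-middle⁺ ys1 ys2 m)
    ... | here refl = ⊥-elim (proj₁ (Unique-middle⁻ ys1 ys2 uy) m)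
    ... | there m' = m'

  pigeonhole : ∀ {A : Set} {xs ys : List A} → Unique xs → (∀ z → z ∈ xs → z ∈ ys) → length ys ≤ length xs →
    Unique ys × (∀ z → z ∈ ys → z ∈ xs)
  pigeonhole {xs = []} {[]} _ _ _ = [] , λ z ()
  pigeonhole {xs = []} {y ∷ ys} _ _ ()
  pigeonhole {xs = x ∷ xs} {ys} (ax ∷ ux) f le with ∈-∃++ (f x (here refl))
  ... | ys1 , ys2 , refl with pigeonhole {xs = xs} {ys = ys1 ++ ys2} ux
          (λ z m → ∈-middle⁻ ys1 ys2 (f z (there m)) (λ e → All¬⇒¬Any ax (subst (_∈ xs) e m)))
          (≤-pred (subst (_≤ suc (length xs)) (trans (length-++ ys1) (trans (+-suc (length ys1) (length ys2)) (cong suc (sym (length-++ ys1))))) le))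
  ... | u' , b' = Unique-middle⁺ ys1 ys2 (λ m → All¬⇒¬Any ax (b' _ m)) u' , ⊆xs
    where
    ⊆xs : ∀ z → z ∈ ys1 ++ x ∷ ys2 → z ∈ x ∷ xs
    ⊆xs z m with ∈-resp-↭ (shift x ys1 ys2) m
    ... | here e = here e
    ... | there m' = there (b' z m')

  Unique-map-injectiveOn : ∀ {A B : Set} (g : A → B) xs → Unique xs →
    (∀ x y → x ∈ xs → y ∈ xs → g x ≡ g y → x ≡ y) → Unique (map g xs)
  Unique-map-injectiveOn g [] _ _ = []
  Unique-map-injectiveOn g (x ∷ xs) (ax ∷ ux) inj =
    ¬Any⇒All¬ _ gx∉ ∷ Unique-map-injectiveOn g xs ux (λ a b ma mb e → inj a b (there ma) (there mb) e)
    where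
    gx∉ : g x ∉ map g xs
    gx∉ m with ∈-map⁻ g m
    ... | y , my , e = All¬⇒¬Any ax (subst (_∈ xs) (sym (inj x y (here refl) (there my) e)) my)

  inverseOn⇒map-↭ : ∀ {A B : Set} {xs : List A} {ys : List B} (g : A → B) (h : B → A) → Unique xs → Unique ys →
    (∀ x → x ∈ xs → g x ∈ ys × h (g x) ≡ x) → (∀ y → y ∈ ys → h y ∈ xs × g (h y) ≡ y) → map g xs ↭ ys
  inverseOn⇒map-↭ {xs = xs} {ys} g h ux uy hg gh =
    Unique-sameElements⇒↭ (Unique-map-injectiveOn g xs ux g-injective) uy image⊆ys ys⊆image
    where
    g-injective : ∀ x y → x ∈ xs → y ∈ xs → g x ≡ g y → x ≡ y
    g-injective x y mx my e = trans (sym (proj₂ (hg x mx))) (trans (cong h e) (proj₂ (hg y my)))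
    image⊆ys : ∀ z → z ∈ map g xs → z ∈ ys
    image⊆ys z m with ∈-map⁻ g m
    ... | x , mx , refl = proj₁ (hg x mx)
    ys⊆image : ∀ z → z ∈ ys → z ∈ map g xs
    ys⊆image z m = subst (_∈ map g xs) (proj₂ (gh z m)) (∈-map⁺ g (proj₁ (gh z m)))

  Unique-++ : ∀ {A : Set} {xs ys : List A} → Unique xs → Unique ys → (∀ z → z ∈ xs → z ∈ ys → ⊥) → Unique (xs ++ ys)
  Unique-++ ux uy d = UP.++⁺ ux uy (λ (a , b) → d _ a b)

  Unique-concatMap : ∀ {A B : Set} (f : A → List B) xs → Unique xs → (∀ x → Unique (f x)) →
    (∀ x y z → z ∈ f x → z ∈ f y → x ≡ y) → Unique (concatMap f xs)
  Unique-concatMap f [] _ _ _ = []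
  Unique-concatMap f (x ∷ xs) (ax ∷ ux) uf d = Unique-++ (uf x) (Unique-concatMap f xs ux uf d) dis
    where
    dis : ∀ z → z ∈ f x → z ∈ concatMap f xs → ⊥
    dis z m1 m2 with find (∈-concatMap⁻ f {xs = xs} m2)
    ... | y , my , m3 = All¬⇒¬Any ax (subst (_∈ xs) (sym (d x y z m1 m3)) my)

  ∈⇒∈ᵇ-true : ∀ {x} E → x ∈ E → (x ∈ᵇ E) ≡ true
  ∈⇒∈ᵇ-true {x} (y ∷ E) (here refl) rewrite ≡ᵇ-refl x = refl
  ∈⇒∈ᵇ-true {x} (y ∷ E) (there m) rewrite ∈⇒∈ᵇ-true E m with x ≡ᵇ y
  ... | true = refl
  ... | false = refl

  ∉⇒∈ᵇ-false : ∀ {x} E → x ∉ E → (x ∈ᵇ E) ≡ false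
  ∉⇒∈ᵇ-false [] _ = refl
  ∉⇒∈ᵇ-false {x} (y ∷ E) x∉ rewrite ≢⇒≡ᵇ-false x y (λ e → x∉ (here e)) = ∉⇒∈ᵇ-false E (λ m → x∉ (there m))

  ∈ᵇ-true⇒∈ : ∀ {x} E → (x ∈ᵇ E) ≡ true → x ∈ E
  ∈ᵇ-true⇒∈ {x} (y ∷ E) e with x ≡ᵇ y in ex
  ... | true = here (≡ᵇ-true⇒≡ x y ex)
  ... | false = there (∈ᵇ-true⇒∈ E e)

  all-true⇒∈⇒true : ∀ {A : Set} (p : A → Bool) xs → all p xs ≡ true → ∀ x → x ∈ xs → p x ≡ true
  all-true⇒∈⇒true p (y ∷ xs) e x (here refl) with p y
  ... | true = refl
  all-true⇒∈⇒true p (y ∷ xs) e x (there m) with p y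
  ... | true = all-true⇒∈⇒true p xs e x m

  ∈⇒true⇒all-true : ∀ {A : Set} (p : A → Bool) xs → (∀ x → x ∈ xs → p x ≡ true) → all p xs ≡ true
  ∈⇒true⇒all-true p [] h = refl
  ∈⇒true⇒all-true p (y ∷ xs) h rewrite h y (here refl) = ∈⇒true⇒all-true p xs (λ x m → h x (there m))

  ∈ᵇ-filter : ∀ (p : ℕ → Bool) D i → i ∈ D → (i ∈ᵇ filter (λ i → p i Data.Bool.≟ true) D) ≡ p i
  ∈ᵇ-filter p D i i∈D with p i in e
  ... | true = ∈⇒∈ᵇ-true _ (∈-filter⁺ (λ i → p i Data.Bool.≟ true) i∈D e)
  ... | false = ∉⇒∈ᵇ-false _ (λ i∈ → true≢false (sym (trans (sym e) (proj₂ (∈-filter⁻ (λ i → p i Data.Bool.≟ true) {xs = D} i∈)))))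

  filter-cong : ∀ (p p' : ℕ → Bool) D → (∀ x → x ∈ D → p x ≡ p' x) →
    filter (λ i → p i Data.Bool.≟ true) D ≡ filter (λ i → p' i Data.Bool.≟ true) D
  filter-cong p p' [] h = refl
  filter-cong p p' (x ∷ D) h with p x | p' x | h x (here refl)
  ... | true | true | _ = cong (x ∷_) (filter-cong p p' D (λ y m → h y (there m)))
  ... | false | false | _ = filter-cong p p' D (λ y m → h y (there m))

  filter-pos : ∀ {A : Set} (p : A → Bool) xs {x} → x ∈ xs → p x ≡ true → 1 ≤ length (filter (λ s → p s Data.Bool.≟ true) xs)
  filter-pos p (y ∷ xs) (here refl) e rewrite e = s≤s z≤n
  filter-pos p (y ∷ xs) (there m) e with p y
  ... | true = s≤s z≤n
  ... | false = filter-pos p xs m e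

  count-↭ : ∀ (p : ℕ → Bool) {xs ys} → xs ↭ ys → count p xs ≡ count p ys
  count-↭ p q = ↭-length (filter-↭ (λ x → p x Data.Bool.≟ true) q)

  count-++ : ∀ (p : ℕ → Bool) xs ys → count p (xs ++ ys) ≡ count p xs + count p ys
  count-++ p [] ys = refl
  count-++ p (x ∷ xs) ys with p x
  ... | true = cong suc (count-++ p xs ys)
  ... | false = count-++ p xs ys

  count-map : ∀ (p : ℕ → Bool) (f : ℕ → ℕ) xs → count p (map f xs) ≡ count (p ∘ f) xs
  count-map p f [] = refl
  count-map p f (x ∷ xs) with p (f x)
  ... | true = cong suc (count-map p f xs)
  ... | false = count-map p f xs

  count-cong : ∀ (p p' : ℕ → Bool) xs → (∀ x → x ∈ xs → p x ≡ p' x) → count p xs ≡ count p' xs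
  count-cong p p' [] h = refl
  count-cong p p' (x ∷ xs) h with p x | p' x | h x (here refl)
  ... | true | true | _ = cong suc (count-cong p p' xs (λ y m → h y (there m)))
  ... | false | false | _ = count-cong p p' xs (λ y m → h y (there m))

  count-true : ∀ (xs : List ℕ) → count (λ _ → true) xs ≡ length xs
  count-true [] = refl
  count-true (x ∷ xs) = cong suc (count-true xs)

  count-≤ : ∀ (p : ℕ → Bool) xs → count p xs ≤ length xs
  count-≤ p [] = z≤n
  count-≤ p (x ∷ xs) with p x
  ... | true = s≤s (count-≤ p xs)
  ... | false = m≤n⇒m≤1+n (count-≤ p xs)

  count-mono : ∀ (p p' : ℕ → Bool) xs → (∀ x → x ∈ xs → p x ≡ true → p' x ≡ true) → count p xs ≤ count p' xs
  count-mono p p' [] h = z≤n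
  count-mono p p' (x ∷ xs) h with p x | p' x | h x (here refl)
  ... | true | true | _ = s≤s (count-mono p p' xs (λ y m → h y (there m)))
  ... | true | false | f with f refl
  ...   | ()
  count-mono p p' (x ∷ xs) h | false | true | _ = m≤n⇒m≤1+n (count-mono p p' xs (λ y m → h y (there m)))
  count-mono p p' (x ∷ xs) h | false | false | _ = count-mono p p' xs (λ y m → h y (there m))

  count-strictMono : ∀ (p p' : ℕ → Bool) xs {x0} → (∀ x → x ∈ xs → p x ≡ true → p' x ≡ true) →
    x0 ∈ xs → p' x0 ≡ true → p x0 ≡ false → count p xs < count p' xs
  count-strictMono p p' (x ∷ xs) h (here refl) e' e rewrite e' | e = s≤s (count-mono p p' xs (λ y m → h y (there m)))
  count-strictMono p p' (x ∷ xs) h (there m) e' e with p x | p' x | h x (here refl)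
  ... | true | true | _ = s≤s (count-strictMono p p' xs (λ y m → h y (there m)) m e' e)
  ... | true | false | f with f refl
  ...   | ()
  count-strictMono p p' (x ∷ xs) h (there m) e' e | false | true | _ = m<n⇒m<1+n (count-strictMono p p' xs (λ y m → h y (there m)) m e' e)
  count-strictMono p p' (x ∷ xs) h (there m) e' e | false | false | _ = count-strictMono p p' xs (λ y m → h y (there m)) m e' e

  count-or : ∀ (p p' : ℕ → Bool) xs → (∀ x → x ∈ xs → (p x ∧ p' x) ≡ false) →
    count (λ x → p x ∨ p' x) xs ≡ count p xs + count p' xs
  count-or p p' [] h = refl
  count-or p p' (x ∷ xs) h with p x | p' x | h x (here refl)
  ... | true | false | _ = cong suc (count-or p p' xs (λ y m → h y (there m)))
  ... | false | true | _ = trans (cong suc (count-or p p' xs (λ y m → h y (there m)))) (sym (+-suc _ _))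
  ... | false | false | _ = count-or p p' xs (λ y m → h y (there m))

  count-zero : ∀ (p : ℕ → Bool) xs → (∀ x → x ∈ xs → p x ≡ false) → count p xs ≡ 0
  count-zero p [] h = refl
  count-zero p (x ∷ xs) h rewrite h x (here refl) = count-zero p xs (λ y m → h y (there m))

  count-at-interval : ∀ (p : ℕ → Bool) w → count p w ≡ count (p ∘ at w) (interval 1 (length w))
  count-at-interval p w = trans (cong (count p) (map-at-interval w)) (count-map p (at w) (interval 1 (length w)))

  count-<-interval-above : ∀ v a k → v ≤ a → count (_<ᵇ v) (interval a k) ≡ 0
  count-<-interval-above v a k le = count-zero _ (interval a k) (λ x m → not-below x (proj₁ (∈-interval⁻ {a} {k} m)))
    where
    not-below : ∀ x → a ≤ x → (x <ᵇ v) ≡ false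
    not-below x ax with x <ᵇ v in e
    ... | false = refl
    ... | true = ⊥-elim (<⇒≱ (<ᵇ⇒< x v (subst T (sym e) tt)) (≤-trans le ax))

  count-<-interval : ∀ v a k → a ≤ v → v ≤ a + k → count (_<ᵇ v) (interval a k) ≡ v ∸ a
  count-<-interval v a zero l u rewrite +-identityʳ a | ≤-antisym l u = sym (n∸n≡0 v)
  count-<-interval v a (suc k) l u with a <ᵇ v in e
  ... | true = trans (cong suc (count-<-interval v (suc a) k (<ᵇ⇒< a v (subst T (sym e) tt)) (subst (v ≤_) (+-suc a k) u)))
                (sym (+-∸-assoc 1 (<ᵇ⇒< a v (subst T (sym e) tt))))
  ... | false with a ≟ v
  ...   | yes refl = trans (count-<-interval-above a (suc a) k (n≤1+n a)) (sym (n∸n≡0 a))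
  ...   | no ne = ⊥-elim (subst T e (<⇒<ᵇ (≤∧≢⇒< l ne)))

  InRange : ℕ → ℕ → Set
  InRange k x = 1 ≤ x × x ≤ k

  IsWord : ℕ → ℕ → List ℕ → Set
  IsWord l k w = length w ≡ l × All (InRange k) w

  words-∈⁺ : ∀ l k w → IsWord l k w → w ∈ words l k
  words-∈⁺ zero k [] _ = here refl
  words-∈⁺ (suc l) k (a ∷ w) (e , (ra ∷ rw)) =
    ∈-concatMap⁺ (λ a → map (a ∷_) (words l k)) {xs = range1 k}
      (Any.map (λ {x} e' → subst (λ x → (a ∷ w) ∈ map (x ∷_) (words l k)) e' (∈-map⁺ (a ∷_) (words-∈⁺ l k w (suc-injective e , rw))))
        (subst (a ∈_) (sym (range1≡interval k)) (∈-interval⁺ {1} {k} (proj₁ ra) (s≤s (proj₂ ra)))))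

  words-∈⁻ : ∀ l k w → w ∈ words l k → IsWord l k w
  words-∈⁻ zero k w (here refl) = refl , []
  words-∈⁻ (suc l) k w m with find (∈-concatMap⁻ (λ a → map (a ∷_) (words l k)) {xs = range1 k} m)
  ... | a , ma , m2 with ∈-map⁻ (a ∷_) m2
  ... | w' , mw' , refl with words-∈⁻ l k w' mw' | ∈-interval⁻ {1} {k} (subst (a ∈_) (range1≡interval k) ma)
  ... | e , rw | l1 , u1 = cong suc e , ((l1 , ≤-pred u1) ∷ rw)

  words-unique : ∀ l k → Unique (words l k)
  words-unique zero k = [] ∷ []
  words-unique (suc l) k = Unique-concatMap (λ a → map (a ∷_) (words l k)) (range1 k)
    (subst Unique (sym (range1≡interval k)) (interval-unique 1 k))
    (λ a → UP.map⁺ ∷-injectiveʳ (words-unique l k))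
    (λ x y z m1 m2 → head-injective x y z m1 m2)
    where
    head-injective : ∀ x y z → z ∈ map (x ∷_) (words l k) → z ∈ map (y ∷_) (words l k) → x ≡ y
    head-injective x y z m1 m2 with ∈-map⁻ (x ∷_) m1 | ∈-map⁻ (y ∷_) m2
    ... | _ , _ , refl | _ , _ , e = ∷-injectiveˡ e

  PW-unique : ∀ n → Unique (PW n)
  PW-unique n = UP.filter⁺ _ (words-unique n n)

  Perms-unique : ∀ n → Unique (Perms n)
  Perms-unique n = UP.filter⁺ _ (words-unique n n)

  PW-∈⁻ : ∀ n w → w ∈ PW n → IsWord n n w × isPacked w ≡ true
  PW-∈⁻ n w m with ∈-filter⁻ (λ w → isPacked w Data.Bool.≟ true) m
  ... | m1 , e = words-∈⁻ n n w m1 , e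

  PW-∈⁺ : ∀ n w → IsWord n n w → isPacked w ≡ true → w ∈ PW n
  PW-∈⁺ n w i e = ∈-filter⁺ (λ w → isPacked w Data.Bool.≟ true) (words-∈⁺ n n w i) e

  Perms-∈⁻ : ∀ n w → w ∈ Perms n → IsWord n n w × isPerm n w ≡ true
  Perms-∈⁻ n w m with ∈-filter⁻ (λ w → isPerm n w Data.Bool.≟ true) m
  ... | m1 , e = words-∈⁻ n n w m1 , e

  Perms-∈⁺ : ∀ n w → IsWord n n w → isPerm n w ≡ true → w ∈ Perms n
  Perms-∈⁺ n w i e = ∈-filter⁺ (λ w → isPerm n w Data.Bool.≟ true) (words-∈⁺ n n w i) e

  sublists : List ℕ → List (List ℕ)
  sublists [] = [] ∷ []
  sublists (x ∷ xs) = map (x ∷_) (sublists xs) ++ sublists xs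

  sublists-⊆ : ∀ D E → E ∈ sublists D → ∀ z → z ∈ E → z ∈ D
  sublists-⊆ [] .[] (here refl) z ()
  sublists-⊆ (x ∷ D) E m z mz with ∈-++⁻ (map (x ∷_) (sublists D)) m
  ... | inj₂ m' = there (sublists-⊆ D E m' z mz)
  ... | inj₁ m' with ∈-map⁻ (x ∷_) m'
  ... | E' , mE' , refl with mz
  ... | here e = here e
  ... | there mz' = there (sublists-⊆ D E' mE' z mz')

  sublists-unique : ∀ D → Unique D → Unique (sublists D)
  sublists-unique [] _ = [] ∷ []
  sublists-unique (x ∷ D) (ax ∷ uD) = Unique-++ (UP.map⁺ ∷-injectiveʳ (sublists-unique D uD)) (sublists-unique D uD) dis
    where
    dis : ∀ z → z ∈ map (x ∷_) (sublists D) → z ∈ sublists D → ⊥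
    dis z m1 m2 with ∈-map⁻ (x ∷_) m1
    ... | E , _ , refl = All¬⇒¬Any ax (sublists-⊆ D (x ∷ E) m2 x (here refl))

  filter∈sublists : ∀ (p : ℕ → Bool) D → filter (λ i → p i Data.Bool.≟ true) D ∈ sublists D
  filter∈sublists p [] = here refl
  filter∈sublists p (x ∷ D) with p x
  ... | true = ∈-++⁺ˡ (∈-map⁺ (x ∷_) (filter∈sublists p D))
  ... | false = ∈-++⁺ʳ (map (x ∷_) (sublists D)) (filter∈sublists p D)

  filter-∈ᵇ-sublist : ∀ D E → Unique D → E ∈ sublists D → filter (λ i → (i ∈ᵇ E) Data.Bool.≟ true) D ≡ E
  filter-∈ᵇ-sublist [] E _ (here refl) = refl
  filter-∈ᵇ-sublist (x ∷ D) E (ax ∷ uD) m with ∈-++⁻ (map (x ∷_) (sublists D)) m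
  ... | inj₂ m' rewrite ∉⇒∈ᵇ-false E (λ mx → All¬⇒¬Any ax (sublists-⊆ D E m' x mx)) = filter-∈ᵇ-sublist D E uD m'
  ... | inj₁ m' with ∈-map⁻ (x ∷_) m'
  ... | E' , mE' , refl rewrite ≡ᵇ-refl x =
    cong (x ∷_) (trans (filter-cong _ _ D (λ y my → cong (_∨ (y ∈ᵇ E')) (≢⇒≡ᵇ-false y x (λ e → All¬⇒¬Any ax (subst (_∈ D) e my)))))
                       (filter-∈ᵇ-sublist D E' uD mE'))

  -- Compositions and their descent sets

  incrementHead : List ℕ → List ℕ
  incrementHead [] = []
  incrementHead (x ∷ r) = suc x ∷ r

  fromBits : List Bool → List ℕ
  fromBits [] = 1 ∷ []
  fromBits (true ∷ bs) = 1 ∷ fromBits bs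
  fromBits (false ∷ bs) = incrementHead (fromBits bs)

  fromBits-nonempty : ∀ bs → Σ ℕ λ y → Σ (List ℕ) λ r → fromBits bs ≡ y ∷ r
  fromBits-nonempty [] = 1 , [] , refl
  fromBits-nonempty (true ∷ bs) = 1 , fromBits bs , refl
  fromBits-nonempty (false ∷ bs) with fromBits-nonempty bs
  ... | y , r , e rewrite e = suc y , r , refl

  fromBits-positive : ∀ bs → All (0 <_) (fromBits bs)
  fromBits-positive [] = s≤s z≤n ∷ []
  fromBits-positive (true ∷ bs) = s≤s z≤n ∷ fromBits-positive bs
  fromBits-positive (false ∷ bs) with fromBits bs | fromBits-positive bs
  ... | [] | _ = []
  ... | y ∷ r | _ ∷ pr = s≤s z≤n ∷ pr

  sum-fromBits : ∀ bs → sum (fromBits bs) ≡ suc (length bs)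
  sum-fromBits [] = refl
  sum-fromBits (true ∷ bs) = cong suc (sum-fromBits bs)
  sum-fromBits (false ∷ bs) with fromBits bs | sum-fromBits bs | fromBits-nonempty bs
  ... | y ∷ r | e | _ = cong suc e
  ... | [] | e | (_ , _ , ())

  partials-shift : ∀ acc y r → partials acc (suc y ∷ r) ≡ partials (suc acc) (y ∷ r)
  partials-shift acc y [] = refl
  partials-shift acc y (b ∷ r) rewrite +-suc acc y = refl

  Des-fromBits : ∀ (β : ℕ → Bool) a k → 1 ≤ a →
    partials (a ∸ 1) (fromBits (map β (interval a k))) ≡ filter (λ d → β d Data.Bool.≟ true) (interval a k)
  Des-fromBits β a zero _ = refl
  Des-fromBits β (suc a) (suc k) _ with β (suc a) | Des-fromBits β (suc (suc a)) k (s≤s z≤n) | fromBits-nonempty (map β (interval (suc (suc a)) k))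
  ... | true | ih | y , r , e rewrite e | +-comm a 1 = cong (suc a ∷_) ih
  ... | false | ih | y , r , e rewrite e = trans (partials-shift a y r) ih

  fromBits-allTrue : ∀ bs → and bs ≡ true → fromBits bs ≡ replicate (suc (length bs)) 1
  fromBits-allTrue [] _ = refl
  fromBits-allTrue (true ∷ bs) e = cong (1 ∷_) (fromBits-allTrue bs e)
  fromBits-allTrue (false ∷ bs) ()

  fromBits-notAllTrue : ∀ bs → and bs ≡ false → fromBits bs ≢ replicate (suc (length bs)) 1
  fromBits-notAllTrue [] ()
  fromBits-notAllTrue (true ∷ bs) e eq = fromBits-notAllTrue bs e (∷-injectiveʳ eq)
  fromBits-notAllTrue (false ∷ bs) e eq with fromBits bs | fromBits-positive bs
  fromBits-notAllTrue (false ∷ bs) e () | [] | _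
  ... | y ∷ r | py ∷ _ = <⇒≢ (s≤s py) (sym (∷-injectiveˡ eq))

  allOnes-==ᴸ-fromBits : ∀ bs → (replicate (suc (length bs)) 1 ==ᴸ fromBits bs) ≡ and bs
  allOnes-==ᴸ-fromBits bs with and bs in e
  ... | true = dec-true (≡-dec _≟_ _ _) (sym (fromBits-allTrue bs e))
  ... | false = dec-false (≡-dec _≟_ _ _) (λ eq → fromBits-notAllTrue bs e (sym eq))

  IncreasingFrom : ℕ → List ℕ → Set
  IncreasingFrom a [] = ⊤
  IncreasingFrom a (x ∷ D) = a ≤ x × IncreasingFrom (suc x) D

  partials-increasing-bounded : ∀ acc J → All (0 <_) J →
    IncreasingFrom (suc acc) (partials acc J) × All (_< acc + sum J) (partials acc J)
  partials-increasing-bounded acc [] _ = tt , []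
  partials-increasing-bounded acc (a ∷ []) _ = tt , []
  partials-increasing-bounded acc (a ∷ b ∷ r) (pa ∷ pb ∷ pr) with partials-increasing-bounded (acc + a) (b ∷ r) (pb ∷ pr)
  ... | (inc , bd) =
    (subst (_≤ acc + a) (+-comm acc 1) (+-monoʳ-≤ acc pa) , inc) ,
    (+-monoʳ-< acc (m<m+n a (<-≤-trans pb (m≤m+n b (sum r)))) ∷ All.map (λ {x} h → subst (x <_) (+-assoc acc a (b + sum r)) h) bd)

  Des-increasing-bounded : ∀ n (J : List ℕ) → IsComposition n J → IncreasingFrom 1 (Des J) × All (_< n) (Des J)
  Des-increasing-bounded n J (pos , s) with partials-increasing-bounded 0 J pos
  ... | (i , b) = i , subst (λ m → All (_< m) (Des J)) s b

  IncreasingFrom⇒∈sublists : ∀ a k D → IncreasingFrom a D → All (_< a + k) D → D ∈ sublists (interval a k)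
  IncreasingFrom⇒∈sublists a zero [] _ _ = here refl
  IncreasingFrom⇒∈sublists a zero (x ∷ D) (a≤x , _) (x<a+0 ∷ _) =
    ⊥-elim (<⇒≱ (subst (x <_) (+-identityʳ a) x<a+0) a≤x)
  IncreasingFrom⇒∈sublists a (suc k) [] _ _ =
    ∈-++⁺ʳ (map (a ∷_) (sublists (interval (suc a) k))) (IncreasingFrom⇒∈sublists (suc a) k [] tt [])
  IncreasingFrom⇒∈sublists a (suc k) (x ∷ D) (a≤x , inc) D< with x ≟ a
  ... | yes refl = ∈-++⁺ˡ (∈-map⁺ (x ∷_) (IncreasingFrom⇒∈sublists (suc x) k D inc (All.map (λ {y} → subst (y <_) (+-suc x k)) (All.tail D<))))
  ... | no x≢a = ∈-++⁺ʳ (map (a ∷_) (sublists (interval (suc a) k)))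
         (IncreasingFrom⇒∈sublists (suc a) k (x ∷ D) (≤∧≢⇒< a≤x (x≢a ∘ sym) , inc) (All.map (λ {y} → subst (y <_) (+-suc a k)) D<))

  Des∈sublists : ∀ N J → IsComposition (suc N) J → Des J ∈ sublists (interval 1 N)
  Des∈sublists N J isComp = IncreasingFrom⇒∈sublists 1 N (Des J) (proj₁ bounds) (proj₂ bounds)
    where bounds = Des-increasing-bounded (suc N) J isComp

  -- Standardization

  stdAux-len : ∀ ua u → length (stdAux ua u) ≡ length u
  stdAux-len ua [] = refl
  stdAux-len ua (x ∷ u) = cong suc (stdAux-len ua u)

  stdAux-at : ∀ ua u j → 1 ≤ j → j ≤ length u →
    at (stdAux ua u) j ≡ suc (count (_<ᵇ at u j) ua + count (at u j ≡ᵇ_) (drop j u))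
  stdAux-at ua (x ∷ u) (suc zero) _ _ = refl
  stdAux-at ua (x ∷ u) (suc (suc j)) _ (s≤s l) = stdAux-at ua u (suc j) (s≤s z≤n) l

  stdAux-ua : ∀ ua ua' u → (∀ x → count (_<ᵇ x) ua ≡ count (_<ᵇ x) ua') → stdAux ua u ≡ stdAux ua' u
  stdAux-ua ua ua' [] h = refl
  stdAux-ua ua ua' (x ∷ u) h = cong₂ _∷_ (cong (λ c → suc (c + count (x ≡ᵇ_) u)) (h x)) (stdAux-ua ua ua' u h)

  σ≡stdAux : ∀ w → σ w ≡ stdAux w w
  σ≡stdAux w = trans (reverse-involutive _)
    (trans (cong (stdAux (reverse w)) (reverse-involutive w))
           (stdAux-ua (reverse w) w w (λ x → count-↭ (_<ᵇ x) (↭-reverse w))))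

  length-σ : ∀ w → length (σ w) ≡ length w
  length-σ w = trans (cong length (σ≡stdAux w)) (stdAux-len w w)

  -- Position j of w lies above position k when σ_w(j) > σ_w(k); since σ standardizes the mirror
  -- image, among equal letters the rightmost one is the lowest.
  aboveᵇ : List ℕ → ℕ → ℕ → Bool
  aboveᵇ w j k = (at w k <ᵇ at w j) ∨ ((j <ᵇ k) ∧ (at w j ≡ᵇ at w k))

  count-drop-at : ∀ (p : ℕ → Bool) w j → j ≤ length w →
    count p (drop j w) ≡ count (λ k → (j <ᵇ k) ∧ p (at w k)) (interval 1 (length w))
  count-drop-at p w j j≤n = begin
      count p (drop j w)
    ≡⟨ cong (count p) (drop-map-at w j) ⟩
      count p (map (at w) after)
    ≡⟨ count-map p (at w) after ⟩
      count (p ∘ at w) after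
    ≡⟨ count-cong _ _ after (λ k m → cong (_∧ p (at w k)) (sym (<⇒<ᵇ-true (proj₁ (∈-interval⁻ {suc j} {n ∸ j} m))))) ⟩
      count q after
    ≡⟨ cong (_+ count q after) (sym (count-zero q (interval 1 j) before-false)) ⟩
      count q (interval 1 j) + count q after
    ≡⟨ sym (count-++ q (interval 1 j) after) ⟩
      count q (interval 1 j ++ after)
    ≡⟨ cong (count q) (sym (trans (cong (interval 1) (sym (m+[n∸m]≡n j≤n))) (interval-++ 1 j (n ∸ j)))) ⟩
      count q (interval 1 n)
    ∎
    where
    open ≡-Reasoning
    n = length w
    after = interval (suc j) (n ∸ j)
    q : ℕ → Bool
    q k = (j <ᵇ k) ∧ p (at w k)
    before-false : ∀ k → k ∈ interval 1 j → q k ≡ false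
    before-false k m = cong (_∧ p (at w k)) (≥⇒<ᵇ-false (≤-pred (proj₂ (∈-interval⁻ {1} {j} m))))

  at-σ : ∀ w j → 1 ≤ j → j ≤ length w → at (σ w) j ≡ suc (count (aboveᵇ w j) (interval 1 (length w)))
  at-σ w j l u = begin
      at (σ w) j
    ≡⟨ cong (λ v → at v j) (σ≡stdAux w) ⟩
      at (stdAux w w) j
    ≡⟨ stdAux-at w w j l u ⟩
      suc (count (_<ᵇ x) w + count (x ≡ᵇ_) (drop j w))
    ≡⟨ cong suc (cong₂ _+_ (count-at-interval (_<ᵇ x) w) (count-drop-at (x ≡ᵇ_) w j u)) ⟩
      suc (count (λ k → at w k <ᵇ x) (interval 1 n) + count (λ k → (j <ᵇ k) ∧ (x ≡ᵇ at w k)) (interval 1 n))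
    ≡⟨ cong suc (sym (count-or _ _ (interval 1 n) disjoint)) ⟩
      suc (count (aboveᵇ w j) (interval 1 n))
    ∎
    where
    open ≡-Reasoning
    x = at w j
    n = length w
    disjoint : ∀ k → k ∈ interval 1 n → ((at w k <ᵇ x) ∧ ((j <ᵇ k) ∧ (x ≡ᵇ at w k))) ≡ false
    disjoint k _ with at w k <ᵇ x in e
    ... | false = refl
    ... | true with j <ᵇ k
    ...   | false = refl
    ...   | true = ≢⇒≡ᵇ-false x (at w k) (λ eq → <-irrefl (sym eq) (<ᵇ-true⇒< e))

  Above : List ℕ → ℕ → ℕ → Set
  Above w j k = at w k < at w j ⊎ (j < k × at w j ≡ at w k)

  Above⇒aboveᵇ : ∀ w j k → Above w j k → aboveᵇ w j k ≡ true
  Above⇒aboveᵇ w j k (inj₁ p) rewrite <⇒<ᵇ-true p = refl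
  Above⇒aboveᵇ w j k (inj₂ (p , e)) with at w k <ᵇ at w j
  ... | true = refl
  ... | false rewrite <⇒<ᵇ-true p | ≡⇒≡ᵇ-true e = refl

  aboveᵇ⇒Above : ∀ w j k → aboveᵇ w j k ≡ true → Above w j k
  aboveᵇ⇒Above w j k e with at w k <ᵇ at w j in e1
  ... | true = inj₁ (<ᵇ-true⇒< e1)
  ... | false with j <ᵇ k in e2
  ...   | true = inj₂ (<ᵇ-true⇒< e2 , ≡ᵇ-true⇒≡ _ _ e)

  aboveᵇ-irrefl : ∀ w j → aboveᵇ w j j ≡ false
  aboveᵇ-irrefl w j rewrite ≥⇒<ᵇ-false {at w j} ≤-refl | ≥⇒<ᵇ-false {j} ≤-refl = refl

  Above-trans : ∀ w j k l → Above w j k → Above w k l → Above w j l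
  Above-trans w j k l (inj₁ p) (inj₁ q) = inj₁ (<-trans q p)
  Above-trans w j k l (inj₁ p) (inj₂ (_ , e)) = inj₁ (subst (_< at w j) e p)
  Above-trans w j k l (inj₂ (_ , e)) (inj₁ q) = inj₁ (subst (at w l <_) (sym e) q)
  Above-trans w j k l (inj₂ (p , e)) (inj₂ (q , e')) = inj₂ (<-trans p q , trans e e')

  Above-total : ∀ w j k → j ≢ k → Above w j k ⊎ Above w k j
  Above-total w j k ne with <-cmp (at w j) (at w k)
  ... | tri< a _ _ = inj₂ (inj₁ a)
  ... | tri> _ _ c = inj₁ (inj₁ c)
  ... | tri≈ _ b _ with <-cmp j k
  ...   | tri< a _ _ = inj₁ (inj₂ (a , b))
  ...   | tri≈ _ e _ = ⊥-elim (ne e)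
  ...   | tri> _ _ c = inj₂ (inj₂ (c , sym b))

  at-σ-reverses-Above : ∀ w j k → 1 ≤ j → j ≤ length w → 1 ≤ k → k ≤ length w → Above w j k → at (σ w) k < at (σ w) j
  at-σ-reverses-Above w j k lj uj lk uk b rewrite at-σ w j lj uj | at-σ w k lk uk =
    s≤s (count-strictMono (aboveᵇ w k) (aboveᵇ w j) (interval 1 (length w))
      (λ l _ e → Above⇒aboveᵇ w j l (Above-trans w j k l b (aboveᵇ⇒Above w k l e)))
      (∈-interval⁺ {1} lk (s≤s uk)) (Above⇒aboveᵇ w j k b) (aboveᵇ-irrefl w k))

  -- Permutations

  IsPerm : ℕ → List ℕ → Set
  IsPerm n π = length π ≡ n × (∀ j → 1 ≤ j → j ≤ n → InRange n (at π j)) ×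
              (∀ i j → 1 ≤ i → i ≤ n → 1 ≤ j → j ≤ n → at π i ≡ at π j → i ≡ j)

  σ-isPerm : ∀ w → IsPerm (length w) (σ w)
  σ-isPerm w = length-σ w , rng , inj
    where
    n = length w
    rng : ∀ j → 1 ≤ j → j ≤ n → InRange n (at (σ w) j)
    rng j l u rewrite at-σ w j l u = s≤s z≤n ,
      subst (suc (count (aboveᵇ w j) (interval 1 n)) ≤_) (trans (count-true (interval 1 n)) (length-interval 1 n))
        (count-strictMono (aboveᵇ w j) (λ _ → true) (interval 1 n) (λ _ _ _ → refl) (∈-interval⁺ {1} l (s≤s u)) refl (aboveᵇ-irrefl w j))
    inj : ∀ i j → 1 ≤ i → i ≤ n → 1 ≤ j → j ≤ n → at (σ w) i ≡ at (σ w) j → i ≡ j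
    inj i j li ui lj uj e with i ≟ j
    ... | yes p = p
    ... | no ne with Above-total w i j ne
    ...   | inj₁ b = ⊥-elim (<-irrefl (sym e) (at-σ-reverses-Above w i j li ui lj uj b))
    ...   | inj₂ b = ⊥-elim (<-irrefl e (at-σ-reverses-Above w j i lj uj li ui b))

  InRange⇒∈interval : ∀ {n z} → InRange n z → z ∈ interval 1 n
  InRange⇒∈interval (l , u) = ∈-interval⁺ {1} l (s≤s u)

  interval⊆Unique-InRange : ∀ n π → Unique π → All (InRange n) π → length π ≡ n → ∀ z → z ∈ interval 1 n → z ∈ π
  interval⊆Unique-InRange n π unique inRange length≡ = proj₂ (pigeonhole unique
    (λ z z∈π → InRange⇒∈interval (All.lookup inRange z∈π)) (≤-reflexive (trans (length-interval 1 n) (sym length≡))))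

  Unique⇒∈Perms : ∀ n π → Unique π → All (InRange n) π → length π ≡ n → π ∈ Perms n
  Unique⇒∈Perms n π unique inRange length≡ = Perms-∈⁺ n π (length≡ , inRange)
    (∈⇒true⇒all-true _ (range1 n) (λ k k∈ → ∈⇒∈ᵇ-true π
      (interval⊆Unique-InRange n π unique inRange length≡ k (subst (k ∈_) (range1≡interval n) k∈))))

  module IsPermProperties {n} {π} (isPerm : IsPerm n π) where
    length≡ = proj₁ isPerm
    unique : Unique π
    unique = at-injective⇒Unique π (λ i j li ui lj uj e → proj₂ (proj₂ isPerm) i j li (subst (i ≤_) length≡ ui) lj (subst (j ≤_) length≡ uj) e)
    inRange : All (InRange n) π
    inRange = all-at π (λ i l u → proj₁ (proj₂ isPerm) i l (subst (i ≤_) length≡ u))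
    interval⊆ : ∀ z → z ∈ interval 1 n → z ∈ π
    interval⊆ = interval⊆Unique-InRange n π unique inRange length≡
    ↭interval : π ↭ interval 1 n
    ↭interval = Unique-sameElements⇒↭ unique (interval-unique 1 n)
      (λ z z∈π → InRange⇒∈interval (All.lookup inRange z∈π)) interval⊆
    ∈Perms : π ∈ Perms n
    ∈Perms = Unique⇒∈Perms n π unique inRange length≡

  ∈Perms⇒IsPerm : ∀ n π → π ∈ Perms n → IsPerm n π
  ∈Perms⇒IsPerm n π π∈ with Perms-∈⁻ n π π∈
  ... | (length≡ , inRange) , isPerm-true = length≡ , at-inRange , at-injective
    where
    interval⊆ : ∀ z → z ∈ interval 1 n → z ∈ π
    interval⊆ z z∈ = ∈ᵇ-true⇒∈ π (all-true⇒∈⇒true _ (range1 n) isPerm-true z (subst (z ∈_) (sym (range1≡interval n)) z∈))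
    unique : Unique π
    unique = proj₁ (pigeonhole (interval-unique 1 n) interval⊆ (≤-reflexive (trans length≡ (sym (length-interval 1 n)))))
    at-inRange : ∀ j → 1 ≤ j → j ≤ n → InRange n (at π j)
    at-inRange j l u = All.lookup inRange (at-∈ π j l (subst (j ≤_) (sym length≡) u))
    at-injective : ∀ i j → 1 ≤ i → i ≤ n → 1 ≤ j → j ≤ n → at π i ≡ at π j → i ≡ j
    at-injective i j li ui lj uj = Unique⇒at-injective π unique i j li (subst (i ≤_) (sym length≡) ui) lj (subst (j ≤_) (sym length≡) uj)

  posOf-∈ : ∀ {v} u → v ∈ u → 1 ≤ posOf v u × posOf v u ≤ length u × at u (posOf v u) ≡ v
  posOf-∈ {v} (x ∷ u) m with v ≡ᵇ x in e
  ... | true = s≤s z≤n , s≤s z≤n , sym (≡ᵇ-true⇒≡ v x e)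
  ... | false with m
  ...   | here refl = ⊥-elim (≡ᵇ-false⇒≢ {v} {v} e refl)
  ...   | there m' rewrite ∈⇒∈ᵇ-true u m' with posOf-∈ u m'
  ...     | l , up , eq = s≤s z≤n , s≤s up , trans (at-suc x u (posOf v u) l) eq

  posOf-at : ∀ u → Unique u → ∀ j → 1 ≤ j → j ≤ length u → posOf (at u j) u ≡ j
  posOf-at u uq j l up with posOf-∈ u (at-∈ u j l up)
  ... | l' , up' , e = Unique⇒at-injective u uq _ j l' up' l up e

  length-invPerm : ∀ π → length (invPerm π) ≡ length π
  length-invPerm π = trans (length-map _ (range1 (length π))) (length-range1 (length π))

  module InvPermProperties {n π} (isPerm : IsPerm n π) where
    open IsPermProperties {n} {π} isPerm
    π⁻¹ : List ℕ
    π⁻¹ = invPerm π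
    at-π⁻¹ : ∀ v → 1 ≤ v → v ≤ n → at π⁻¹ v ≡ posOf v π
    at-π⁻¹ v l u = trans (at-map (λ v → posOf v π) (range1 (length π)) v l (subst (v ≤_) (sym (trans (length-range1 _) length≡)) u))
                         (cong (λ x → posOf x π) (at-range1 (length π) v l (subst (v ≤_) (sym length≡) u)))
    π∘π⁻¹ : ∀ v → 1 ≤ v → v ≤ n → 1 ≤ at π⁻¹ v × at π⁻¹ v ≤ n × at π (at π⁻¹ v) ≡ v
    π∘π⁻¹ v l u with posOf-∈ π (interval⊆ v (∈-interval⁺ {1} l (s≤s u)))
    ... | a , b , c rewrite at-π⁻¹ v l u = a , subst (_ ≤_) length≡ b , c
    π⁻¹∘π : ∀ j → 1 ≤ j → j ≤ n → at π⁻¹ (at π j) ≡ j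
    π⁻¹∘π j l u with proj₁ (proj₂ isPerm) j l u
    ... | l' , u' = trans (at-π⁻¹ (at π j) l' u') (posOf-at π unique j l (subst (j ≤_) (sym length≡) u))
    π⁻¹-isPerm : IsPerm n π⁻¹
    π⁻¹-isPerm = trans (length-invPerm π) length≡ ,
      (λ v l u → proj₁ (π∘π⁻¹ v l u) , proj₁ (proj₂ (π∘π⁻¹ v l u))) ,
      (λ i j li ui lj uj e → trans (sym (proj₂ (proj₂ (π∘π⁻¹ i li ui))))
                            (trans (cong (at π) e) (proj₂ (proj₂ (π∘π⁻¹ j lj uj)))))

  invPerm-involutive : ∀ {n π} (isPerm : IsPerm n π) → invPerm (invPerm π) ≡ π
  invPerm-involutive {n} {π} isPerm = at-extensionality (invPerm π⁻¹) π (trans (length-invPerm π⁻¹) (trans (length-invPerm π) refl)) pointwise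
    where
    open InvPermProperties {n} {π} isPerm
    module I2 = InvPermProperties {n} {invPerm π} π⁻¹-isPerm
    pointwise : ∀ j → 1 ≤ j → j ≤ length (invPerm π⁻¹) → at (invPerm π⁻¹) j ≡ at π j
    pointwise j l u with subst (j ≤_) (trans (length-invPerm π⁻¹) (trans (length-invPerm π) (proj₁ isPerm))) u
    ... | u' with proj₁ (proj₂ isPerm) j l u'
    ... | l2 , u2 = trans (I2.at-π⁻¹ j l u') (trans (cong (λ x → posOf x π⁻¹) (sym (π⁻¹∘π j l u')))
                      (posOf-at π⁻¹ (IsPermProperties.unique {n} {π⁻¹} π⁻¹-isPerm) (at π j) l2 (subst (_ ≤_) (sym (trans (length-invPerm π) (proj₁ isPerm))) u2)))

  posOf-invPerm : ∀ {n π} → IsPerm n π → ∀ j → 1 ≤ j → j ≤ n → posOf j (invPerm π) ≡ at π j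
  posOf-invPerm {n} {π} isPerm j l u with proj₁ (proj₂ isPerm) j l u
  ... | l2 , u2 = trans (cong (λ x → posOf x (invPerm π)) (sym (π⁻¹∘π j l u)))
                    (posOf-at (invPerm π) (IsPermProperties.unique {n} {invPerm π} π⁻¹-isPerm) (at π j) l2 (subst (_ ≤_) (sym (trans (length-invPerm π) (proj₁ isPerm))) u2))
    where open InvPermProperties {n} {π} isPerm

  OrderCompatible : ℕ → List ℕ → List ℕ → Set
  OrderCompatible n w π =
    (∀ j k → 1 ≤ j → j ≤ n → 1 ≤ k → k ≤ n → at w j < at w k → at π j < at π k) ×
    (∀ j k → 1 ≤ j → j ≤ n → 1 ≤ k → k ≤ n → at w j ≡ at w k → j < k → at π k < at π j)

  OrderCompatible-Above : ∀ {n w π} → OrderCompatible n w π →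
    ∀ j k → 1 ≤ j → j ≤ n → 1 ≤ k → k ≤ n → Above w j k → at π k < at π j
  OrderCompatible-Above (increasing , _) j k lj uj lk uk (inj₁ w-below) = increasing k j lk uk lj uj w-below
  OrderCompatible-Above (_ , ties) j k lj uj lk uk (inj₂ (j<k , w-equal)) = ties j k lj uj lk uk w-equal j<k

  OrderCompatible-aboveᵇ : ∀ {n w π} → OrderCompatible n w π →
    ∀ j k → 1 ≤ j → j ≤ n → 1 ≤ k → k ≤ n → aboveᵇ w j k ≡ (at π k <ᵇ at π j)
  OrderCompatible-aboveᵇ {n} {w} {π} compatible j k lj uj lk uk with aboveᵇ w j k in e
  ... | true = sym (<⇒<ᵇ-true (OrderCompatible-Above {n} {w} {π} compatible j k lj uj lk uk (aboveᵇ⇒Above w j k e)))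
  ... | false with k ≟ j
  ...   | yes refl = sym (≥⇒<ᵇ-false {at π k} ≤-refl)
  ...   | no k≢j with Above-total w j k (k≢j ∘ sym)
  ...     | inj₁ above = ⊥-elim (true≢false (trans (sym (Above⇒aboveᵇ w j k above)) e))
  ...     | inj₂ below = sym (≥⇒<ᵇ-false (<⇒≤ (OrderCompatible-Above {n} {w} {π} compatible k j lk uk lj uj below)))

  σ-characterisation : ∀ n w π → length w ≡ n → IsPerm n π → OrderCompatible n w π → σ w ≡ π
  σ-characterisation n w π lw isPerm compatible = at-extensionality (σ w) π (trans (length-σ w) (trans lw (sym length≡))) at-σ≡at-π
    where
    open IsPermProperties {n} {π} isPerm
    at-σ≡at-π : ∀ j → 1 ≤ j → j ≤ length (σ w) → at (σ w) j ≡ at π j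
    at-σ≡at-π j l u′ = begin
        at (σ w) j
      ≡⟨ at-σ w j l (subst (j ≤_) (sym lw) u) ⟩
        suc (count (aboveᵇ w j) (interval 1 (length w)))
      ≡⟨ cong (λ m → suc (count (aboveᵇ w j) (interval 1 m))) lw ⟩
        suc (count (aboveᵇ w j) (interval 1 n))
      ≡⟨ cong suc (count-cong _ _ (interval 1 n) (λ k k∈ → uncurry (OrderCompatible-aboveᵇ {n} {w} {π} compatible j k l u) (bounds k∈))) ⟩
        suc (count (λ k → at π k <ᵇ at π j) (interval 1 n))
      ≡⟨ cong (λ m → suc (count (λ k → at π k <ᵇ at π j) (interval 1 m))) (sym length≡) ⟩
        suc (count (λ k → at π k <ᵇ at π j) (interval 1 (length π)))
      ≡⟨ cong suc (sym (count-at-interval (_<ᵇ at π j) π)) ⟩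
        suc (count (_<ᵇ at π j) π)
      ≡⟨ cong suc (count-↭ (_<ᵇ at π j) ↭interval) ⟩
        suc (count (_<ᵇ at π j) (interval 1 n))
      ≡⟨ cong suc (count-<-interval (at π j) 1 n (proj₁ π-j-range) (≤-trans (proj₂ π-j-range) (n≤1+n n))) ⟩
        suc (at π j ∸ 1)
      ≡⟨ m+[n∸m]≡n (proj₁ π-j-range) ⟩
        at π j
      ∎
      where
      open ≡-Reasoning
      u : j ≤ n
      u = subst (j ≤_) (trans (length-σ w) lw) u′
      π-j-range = proj₁ (proj₂ isPerm) j l u
      bounds : ∀ {k} → k ∈ interval 1 n → 1 ≤ k × k ≤ n
      bounds k∈ = Data.Product.map₂ ≤-pred (∈-interval⁻ k∈)

  ∈Des-word⁺ : ∀ τ i → 1 ≤ i → suc i ≤ length τ → at τ (suc i) < at τ i → i ∈ Des-word τ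
  ∈Des-word⁺ τ i l u lt = ∈-filter⁺ (λ i → (at τ (suc i) <ᵇ at τ i) Data.Bool.≟ true)
    (subst (i ∈_) (sym (range1≡interval _)) (∈-interval⁺ {1} l (s≤s (∸-monoˡ-≤ 1 u)))) (<⇒<ᵇ-true lt)

  ∈Des-word⁻ : ∀ τ i → i ∈ Des-word τ → 1 ≤ i × suc i ≤ length τ × at τ (suc i) < at τ i
  ∈Des-word⁻ τ i m with ∈-filter⁻ (λ i → (at τ (suc i) <ᵇ at τ i) Data.Bool.≟ true) {xs = range1 (length τ ∸ 1)} m
  ... | m1 , e with ∈-interval⁻ {1} {length τ ∸ 1} (subst (i ∈_) (range1≡interval _) m1)
  ... | l , u = l , bound (length τ) l (≤-pred u) , <ᵇ-true⇒< e
    where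
    bound : ∀ L → 1 ≤ i → i ≤ L ∸ 1 → suc i ≤ L
    bound zero (s≤s _) ()
    bound (suc L) _ h = s≤s h

  Des-word-unique : ∀ τ → Unique (Des-word τ)
  Des-word-unique τ = UP.filter⁺ (λ i → (at τ (suc i) <ᵇ at τ i) Data.Bool.≟ true)
    (subst Unique (sym (range1≡interval (length τ ∸ 1))) (interval-unique 1 (length τ ∸ 1)))

  descent-chain : ∀ τ a b → (∀ c → a ≤ c → c < b → at τ (suc c) < at τ c) → a < b → at τ b < at τ a
  descent-chain τ a (suc b) h a<b with m≤n⇒m<n∨m≡n (≤-pred a<b)
  ... | inj₂ refl = h a ≤-refl ≤-refl
  ... | inj₁ a<b' = <-trans (h b (<⇒≤ a<b') ≤-refl) (descent-chain τ a b (λ c ac cb → h c ac (m<n⇒m<1+n cb)) a<b')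

  map-posOf : ∀ (g : ℕ → ℕ) τ → Unique τ → map (λ x → g (posOf x τ)) τ ≡ map g (interval 1 (length τ))
  map-posOf g τ uq = at-extensionality _ _
    (trans (length-map (λ x → g (posOf x τ)) τ) (sym (trans (length-map g (interval 1 (length τ))) (length-interval 1 (length τ))))) pointwise
    where
    pointwise : ∀ i → 1 ≤ i → i ≤ length (map (λ x → g (posOf x τ)) τ) → _
    pointwise i l u with subst (i ≤_) (length-map _ τ) u
    ... | u' = trans (at-map _ τ i l u') (trans (cong g (posOf-at τ uq i l u'))
                 (sym (trans (at-map g (interval 1 (length τ)) i l (subst (i ≤_) (sym (length-interval 1 _)) u')) (cong g (at-interval-from1 _ i l u')))))

  descentsFrom : ℕ → ℕ → List ℕ → List ℕ
  descentsFrom p prev [] = []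
  descentsFrom p prev (y ∷ r) = if prev <ᵇ y then descentsFrom (suc p) y r else p ∷ descentsFrom (suc p) y r

  runsAux-nonempty : ∀ prev k r → runsAux prev k r ≢ []
  runsAux-nonempty prev k [] ()
  runsAux-nonempty prev k (y ∷ r) eq with prev <ᵇ y
  ... | true = runsAux-nonempty y (suc k) r eq
  ... | false with eq
  ...   | ()

  partials-runsAux : ∀ acc prev k r → partials acc (runsAux prev k r) ≡ descentsFrom (acc + k) prev r
  partials-runsAux acc prev k [] = refl
  partials-runsAux acc prev k (y ∷ r) with prev <ᵇ y
  ... | true = trans (partials-runsAux acc y (suc k) r) (cong (λ q → descentsFrom q y r) (+-suc acc k))
  ... | false with runsAux y 1 r in e
  ... | [] = ⊥-elim (runsAux-nonempty y 1 r e)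
  ... | z ∷ zs = cong ((acc + k) ∷_) (trans (cong (partials (acc + k)) (sym e))
                   (trans (partials-runsAux (acc + k) y 1 r) (cong (λ q → descentsFrom q y r) (+-comm (acc + k) 1))))

  descentsFrom≡filter : ∀ (F : ℕ → ℕ) p prev r → F p ≡ prev →
    (∀ i → 1 ≤ i → i ≤ length r → F (p + i) ≡ at r i) →
    (∀ i → p ≤ i → i < p + length r → F (suc i) ≢ F i) →
    descentsFrom p prev r ≡ filter (λ i → (F (suc i) <ᵇ F i) Data.Bool.≟ true) (interval p (length r))
  descentsFrom≡filter F p prev [] _ _ _ = refl
  descentsFrom≡filter F p prev (y ∷ r) Fp Fr dis = cases (<-cmp prev y)
    where
    Fsp : F (suc p) ≡ y
    Fsp = trans (cong F (sym (+-comm p 1))) (Fr 1 (s≤s z≤n) (s≤s z≤n))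
    ih = descentsFrom≡filter F (suc p) y r Fsp
          (λ i l u → trans (cong F (sym (+-suc p i))) (trans (Fr (suc i) (s≤s z≤n) (s≤s u)) (at-suc y r i l)))
          (λ i l u → dis i (≤-trans (n≤1+n p) l) (subst (i <_) (sym (+-suc p (length r))) u))
    cases : Tri (prev < y) (prev ≡ y) (y < prev) →
          descentsFrom p prev (y ∷ r) ≡ filter (λ i → (F (suc i) <ᵇ F i) Data.Bool.≟ true) (interval p (length (y ∷ r)))
    cases (tri< a _ _) rewrite <⇒<ᵇ-true a | Fp | Fsp | ≥⇒<ᵇ-false {y} (<⇒≤ a) = ih
    cases (tri> _ _ c) rewrite ≥⇒<ᵇ-false {prev} (<⇒≤ c) | Fp | Fsp | <⇒<ᵇ-true c = cong (p ∷_) ih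
    cases (tri≈ _ b _) = ⊥-elim (dis p ≤-refl (m<m+n p (s≤s z≤n)) (trans Fsp (trans (sym b) (sym Fp))))

  Des-C : ∀ τ → Unique τ → Des (C τ) ≡ Des-word τ
  Des-C [] _ = refl
  Des-C (x ∷ r) uq = trans (partials-runsAux 0 x 1 r)
    (trans (descentsFrom≡filter (at (x ∷ r)) 1 x r refl (λ i l u → at-suc x r i l)
             (λ i l u e → <-irrefl (sym (Unique⇒at-injective (x ∷ r) uq (suc i) i (s≤s z≤n) (s≤s (≤-pred u)) l (≤-trans (≤-pred u) (n≤1+n _)) e)) (n<1+n i)))
           (cong (filter (λ i → (at (x ∷ r) (suc i) <ᵇ at (x ∷ r) i) Data.Bool.≟ true)) (sym (range1≡interval (length r)))))

  Des-C-Perms : ∀ n τ → τ ∈ Perms n → Des (C τ) ≡ Des-word τ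
  Des-C-Perms n τ m = Des-C τ (IsPermProperties.unique {n} {τ} (∈Perms⇒IsPerm n τ m))

  -- Blocks of consecutive values of sizes J, each block above all later ones: its descent composition is J.
  blockPerm : List ℕ → List ℕ
  blockPerm [] = []
  blockPerm (a ∷ J) = interval (suc (sum J)) a ++ blockPerm J

  runsAux-ascending : ∀ v len k rest → runsAux v k (interval (suc v) len ++ rest) ≡ runsAux (v + len) (k + len) rest
  runsAux-ascending v zero k rest rewrite +-identityʳ v | +-identityʳ k = refl
  runsAux-ascending v (suc len) k rest rewrite <⇒<ᵇ-true (n<1+n v) | +-suc v len | +-suc k len = runsAux-ascending (suc v) len (suc k) rest

  length-blockPerm : ∀ J → length (blockPerm J) ≡ sum J
  length-blockPerm [] = refl
  length-blockPerm (a ∷ J) = trans (length-++ (interval (suc (sum J)) a)) (cong₂ _+_ (length-interval _ a) (length-blockPerm J))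

  blockPerm-inRange : ∀ J → All (InRange (sum J)) (blockPerm J)
  blockPerm-inRange [] = []
  blockPerm-inRange (a ∷ J) = AllP.++⁺ (all-at (interval (suc (sum J)) a) block-inRange)
    (All.map (λ {x} (l , u) → l , ≤-trans u (m≤n+m (sum J) a)) (blockPerm-inRange J))
    where
    block-inRange : ∀ i → 1 ≤ i → i ≤ length (interval (suc (sum J)) a) → InRange (a + sum J) (at (interval (suc (sum J)) a) i)
    block-inRange (suc i) _ u with subst (suc i ≤_) (length-interval _ a) u
    ... | u' rewrite at-interval (suc (sum J)) a i u' = s≤s z≤n ,
      ≤-trans (≤-reflexive (sym (+-suc (sum J) i))) (subst (sum J + suc i ≤_) (+-comm (sum J) a) (+-monoʳ-≤ (sum J) u'))

  blockPerm-unique : ∀ J → Unique (blockPerm J)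
  blockPerm-unique [] = []
  blockPerm-unique (a ∷ J) = Unique-++ (interval-unique _ a) (blockPerm-unique J) disjoint
    where
    disjoint : ∀ z → z ∈ interval (suc (sum J)) a → z ∈ blockPerm J → ⊥
    disjoint z m1 m2 = <⇒≱ (proj₁ (∈-interval⁻ {suc (sum J)} {a} m1)) (proj₂ (All.lookup (blockPerm-inRange J) m2))

  C-blockPerm : ∀ J → J ≢ [] → All (0 <_) J → C (blockPerm J) ≡ J
  C-blockPerm [] ne _ = ⊥-elim (ne refl)
  C-blockPerm (suc a ∷ J) _ (_ ∷ pJ) rewrite runsAux-ascending (suc (sum J)) a 1 (blockPerm J) with blockPerm J in e | C-blockPerm J
  ... | [] | _ with J
  ...   | [] = refl
  ...   | b ∷ J' with pJ
  ...     | pb ∷ _ with interval (suc (sum J')) b | length-interval (suc (sum J')) b | e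
  ...       | [] | lr | _ = ⊥-elim (<-irrefl lr pb)
  ...       | _ ∷ _ | _ | ()
  C-blockPerm (suc a ∷ J) _ (_ ∷ pJ) | y ∷ r | ih with All.lookup (blockPerm-inRange J) (subst (y ∈_) (sym e) (here refl))
  ... | _ , y≤ rewrite ≥⇒<ᵇ-false {suc (sum J) + a} {y} (≤-trans y≤ (≤-trans (n≤1+n _) (m≤m+n (suc (sum J)) a))) =
    cong (suc a ∷_) (ih (nonemp J e) pJ)
    where
    nonemp : ∀ J → blockPerm J ≡ y ∷ r → J ≢ []
    nonemp [] ()
    nonemp (_ ∷ _) _ ()

  dcount-positive : ∀ n J → 1 ≤ n → IsComposition n J → 1 ≤ dcount n J
  dcount-positive n J 1≤n (pos , sum≡n) = filter-pos (λ s → C s ==ᴸ J) (Perms n) blockPerm∈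
    (dec-true (≡-dec _≟_ _ _) (C-blockPerm J J≢[] pos))
    where
    J≢[] : J ≢ []
    J≢[] refl = <-irrefl sum≡n 1≤n
    blockPerm∈ : blockPerm J ∈ Perms n
    blockPerm∈ = Unique⇒∈Perms n (blockPerm J) (blockPerm-unique J)
      (subst (λ m → All (InRange m) (blockPerm J)) sum≡n (blockPerm-inRange J)) (trans (length-blockPerm J) sum≡n)

  Sorted : List ℕ → Set
  Sorted [] = ⊤
  Sorted (x ∷ s) = All (x ≤_) s × Sorted s

  insert-↭ : ∀ x l → insert x l ↭ x ∷ l
  insert-↭ x [] = ↭-refl
  insert-↭ x (y ∷ u) with x ≤ᵇ y
  ... | true = ↭-refl
  ... | false = ↭-trans (prep y (insert-↭ x u)) (swap y x ↭-refl)

  All-insert : ∀ {P : ℕ → Set} x l → P x → All P l → All P (insert x l)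
  All-insert x [] px [] = px ∷ []
  All-insert x (y ∷ u) px (py ∷ pu) with x ≤ᵇ y
  ... | true = px ∷ py ∷ pu
  ... | false = py ∷ All-insert x u px pu

  insert-sorted : ∀ x l → Sorted l → Sorted (insert x l)
  insert-sorted x [] _ = [] , tt
  insert-sorted x (y ∷ u) (ay , su) with x ≤ᵇ y in e
  ... | true = (x≤y ∷ All.map (λ {z} p → ≤-trans x≤y p) ay) , (ay , su)
    where x≤y = ≤ᵇ⇒≤ x y (subst T (sym e) tt)
  ... | false = All-insert x u (<⇒≤ (≰⇒> (λ x≤y → subst T e (≤⇒≤ᵇ x≤y)))) ay , insert-sorted x u su

  sortUp-↭ : ∀ w → sortUp w ↭ w
  sortUp-↭ [] = ↭-refl
  sortUp-↭ (x ∷ w) = ↭-trans (insert-↭ x (sortUp w)) (prep x (sortUp-↭ w))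

  sortUp-sorted : ∀ w → Sorted (sortUp w)
  sortUp-sorted [] = tt
  sortUp-sorted (x ∷ w) = insert-sorted x (sortUp w) (sortUp-sorted w)

  sorted-at : ∀ s → Sorted s → ∀ v i → count (_<ᵇ v) s < i → i ≤ count (_<ᵇ v) s + count (v ≡ᵇ_) s → at s i ≡ v
  sorted-at [] _ v i l u = ⊥-elim (<⇒≱ l u)
  sorted-at (x ∷ s) (ax , ss) v i l u with <-cmp x v
  ... | tri< x<v _ _ rewrite <⇒<ᵇ-true x<v | ≢⇒≡ᵇ-false v x (λ e → <-irrefl (sym e) x<v) with i
  ...   | suc (suc i') = sorted-at s ss v (suc i') (≤-pred l) (≤-pred u)
  ...   | suc zero = ⊥-elim (<⇒≱ l (s≤s z≤n))
  ...   | zero = ⊥-elim (<⇒≱ l z≤n)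
  sorted-at (x ∷ s) (ax , ss) v i l u | tri≈ _ refl _ rewrite ≥⇒<ᵇ-false {x} ≤-refl | ≡ᵇ-refl x with i
  ... | suc zero = refl
  ... | suc (suc i') = sorted-at s ss x (suc i') (subst (_< suc i') (sym cz) (s≤s z≤n)) (≤-pred (subst (suc (suc i') ≤_) (+-suc _ _) u))
    where cz = count-zero (_<ᵇ x) s (λ y m → ≥⇒<ᵇ-false (All.lookup ax m))
  ... | zero = ⊥-elim (<⇒≱ l z≤n)
  sorted-at (x ∷ s) (ax , ss) v i l u | tri> _ _ v<x
    rewrite ≥⇒<ᵇ-false {x} (<⇒≤ v<x) | ≢⇒≡ᵇ-false v x (<⇒≢ v<x)
          | count-zero (_<ᵇ v) s (λ y m → ≥⇒<ᵇ-false (<⇒≤ (<-≤-trans v<x (All.lookup ax m))))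
          | count-zero (v ≡ᵇ_) s (λ y m → ≢⇒≡ᵇ-false v y (<⇒≢ (<-≤-trans v<x (All.lookup ax m)))) = ⊥-elim (<⇒≱ l u)

  sorted-mono : ∀ s → Sorted s → ∀ p q → 1 ≤ p → p ≤ q → q ≤ length s → at s p ≤ at s q
  sorted-mono (x ∷ s) (ax , ss) (suc zero) (suc zero) _ _ _ = ≤-refl
  sorted-mono (x ∷ s) (ax , ss) (suc zero) (suc (suc q)) _ _ (s≤s u) = All.lookup ax (at-∈ s (suc q) (s≤s z≤n) u)
  sorted-mono (x ∷ s) (ax , ss) (suc (suc p)) (suc (suc q)) _ (s≤s pq) (s≤s u) = sorted-mono s ss (suc p) (suc q) (s≤s z≤n) pq u

  Sorted-↭⇒≡ : ∀ a b → Sorted a → Sorted b → a ↭ b → a ≡ b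
  Sorted-↭⇒≡ [] b _ _ p = sym (↭-empty-inv (↭-sym p))
  Sorted-↭⇒≡ (x ∷ a) [] _ _ p = ↭-empty-inv p
  Sorted-↭⇒≡ (x ∷ a) (y ∷ b) (ax , sa) (by , sb) p with ∈-resp-↭ p (here refl) | ∈-resp-↭ (↭-sym p) (here refl)
  ... | mx | my = heads-equal (y≤x mx) (x≤y my)
    where
    y≤x : x ∈ y ∷ b → y ≤ x
    y≤x (here e) = ≤-reflexive (sym e)
    y≤x (there m) = All.lookup by m
    x≤y : y ∈ x ∷ a → x ≤ y
    x≤y (here e) = ≤-reflexive (sym e)
    x≤y (there m) = All.lookup ax m
    heads-equal : y ≤ x → x ≤ y → x ∷ a ≡ y ∷ b
    heads-equal h1 h2 with ≤-antisym h2 h1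
    ... | refl = cong (x ∷_) (Sorted-↭⇒≡ a b sa sb (drop-∷ p))

  Sorted-map-interval : ∀ (f : ℕ → ℕ) a k → (∀ x y → x ≤ y → f x ≤ f y) → Sorted (map f (interval a k))
  Sorted-map-interval f a zero mono = tt
  Sorted-map-interval f a (suc k) mono = all-above (suc a) k (n≤1+n a) , Sorted-map-interval f (suc a) k mono
    where
    all-above : ∀ b k → a ≤ b → All (f a ≤_) (map f (interval b k))
    all-above b zero _ = []
    all-above b (suc k) ab = mono a b ab ∷ all-above (suc b) k (≤-trans ab (n≤1+n b))

  isPacked⇒packed : ∀ w → isPacked w ≡ true → ∀ y → y ∈ w → 1 ≤ y × (y ≡ 1 ⊎ pred y ∈ w)
  isPacked⇒packed w e y m with all-true⇒∈⇒true _ w e y m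
  ... | e' with y ≡ᵇ 0 in e0 | y ≡ᵇ 1 in e1
  ... | false | true = n≢0⇒n>0 (≡ᵇ-false⇒≢ e0) , inj₁ (≡ᵇ-true⇒≡ y 1 e1)
  ... | false | false = n≢0⇒n>0 (≡ᵇ-false⇒≢ e0) , inj₂ (∈ᵇ-true⇒∈ w e')

  module SortedPackedWord (w : List ℕ) (w-packed : isPacked w ≡ true) where
    s = sortUp w
    s-sorted = sortUp-sorted w
    s-packed : ∀ y → y ∈ s → 1 ≤ y × (y ≡ 1 ⊎ pred y ∈ s)
    s-packed y m with isPacked⇒packed w w-packed y (∈-resp-↭ (sortUp-↭ w) m)
    ... | a , inj₁ b = a , inj₁ b
    ... | a , inj₂ b = a , inj₂ (∈-resp-↭ (↭-sym (sortUp-↭ w)) b)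

    head≡1 : 1 ≤ length s → at s 1 ≡ 1
    head≡1 _ with s | s-sorted | s-packed
    ... | x ∷ s' | (ax , _) | pp' with pp' x (here refl)
    ...   | _ , inj₁ e = e
    ...   | l , inj₂ (here e) = ⊥-elim (<-irrefl e (pred< l))
      where pred< : 1 ≤ x → pred x < x
            pred< (s≤s _) = ≤-refl
    ...   | l , inj₂ (there m) = ⊥-elim (<⇒≱ (pred< l) (All.lookup ax m))
      where pred< : 1 ≤ x → pred x < x
            pred< (s≤s _) = ≤-refl

    step≤1 : ∀ i → 1 ≤ i → suc i ≤ length s → at s (suc i) ≡ at s i ⊎ at s (suc i) ≡ suc (at s i)
    step≤1 i l u with m≤n⇒m<n∨m≡n (sorted-mono s s-sorted i (suc i) l (n≤1+n i) u)
    ... | inj₂ e = inj₁ (sym e)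
    ... | inj₁ a<b with m≤n⇒m<n∨m≡n a<b
    ...   | inj₂ e = inj₂ (sym e)
    ...   | inj₁ a+1<b with s-packed (at s (suc i)) (at-∈ s (suc i) (s≤s z≤n) u)
    ...     | _ , inj₁ e = ⊥-elim (<⇒≱ a+1<b (subst (_≤ suc (at s i)) (sym e) (s≤s z≤n)))
    ...     | _ , inj₂ m with ∈-at s m
    ...       | p , lp , up , ep with p ≤? i
    ...         | yes p≤i = ⊥-elim (<⇒≱ (pred-lt a+1<b) (subst (_≤ at s i) ep (sorted-mono s s-sorted p i lp p≤i (≤-trans (n≤1+n i) u))))
      where pred-lt : ∀ {a b} → suc a < b → a < pred b
            pred-lt (s≤s (s≤s q)) = s≤s q
    ...         | no p>i = ⊥-elim (<-irrefl refl (≤-<-trans (subst (at s (suc i) ≤_) ep (sorted-mono s s-sorted (suc i) p (s≤s z≤n) (≰⇒> p>i) up)) (pred-lt2 a+1<b)))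
      where pred-lt2 : ∀ {a b} → suc a < b → pred b < b
            pred-lt2 (s≤s (s≤s q)) = ≤-refl

  -- Packed words as permutations with marked descents

  -- The nondecreasing packed word that stays flat exactly after the positions in E.
  level : List ℕ → ℕ → ℕ
  level E zero = 1
  level E (suc zero) = 1
  level E (suc (suc i)) = if suc i ∈ᵇ E then level E (suc i) else suc (level E (suc i))

  level-step : ∀ E i → level E i ≤ level E (suc i)
  level-step E zero = ≤-refl
  level-step E (suc i) with suc i ∈ᵇ E
  ... | true = ≤-refl
  ... | false = n≤1+n _

  level-mono : ∀ E a b → a ≤ b → level E a ≤ level E b
  level-mono E a b a≤b with m≤n⇒m<n∨m≡n a≤b
  ... | inj₂ refl = ≤-refl
  ... | inj₁ a<b with b
  ...   | suc b' = ≤-trans (level-mono E a b' (≤-pred a<b)) (level-step E b')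

  level-positive : ∀ E i → 1 ≤ level E i
  level-positive E i = ≤-trans (≤-refl {1}) (level-mono E 0 i z≤n)

  level≤ : ∀ E i → 1 ≤ i → level E i ≤ i
  level≤ E (suc zero) _ = ≤-refl
  level≤ E (suc (suc i)) _ = cases (suc i ∈ᵇ E) (level≤ E (suc i) (s≤s z≤n))
    where
    cases : (b : Bool) → level E (suc i) ≤ suc i → (if b then level E (suc i) else suc (level E (suc i))) ≤ suc (suc i)
    cases true h = ≤-trans h (n≤1+n _)
    cases false h = s≤s h

  level-flat⇒∈ : ∀ E a b → a ≤ b → level E a ≡ level E b → ∀ c → 1 ≤ c → a ≤ c → c < b → (c ∈ᵇ E) ≡ true
  level-flat⇒∈ E a b a≤b e (suc c) _ a≤c c<b with suc c ∈ᵇ E in ec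
  ... | true = refl
  ... | false = ⊥-elim (<-irrefl e (<-≤-trans (s≤s (level-mono E a (suc c) a≤c)) step))
    where
    step : suc (level E (suc c)) ≤ level E b
    step = subst (_≤ level E b) (cong (λ x → if x then level E (suc c) else suc (level E (suc c))) ec) (level-mono E (suc (suc c)) b c<b)

  level-pred : ∀ E i → 1 ≤ i → 2 ≤ level E i → Σ ℕ λ i' → 1 ≤ i' × i' ≤ i × level E i' ≡ pred (level E i)
  level-pred E (suc zero) _ (s≤s ())
  level-pred E (suc (suc i)) _ h = cases (suc i ∈ᵇ E) h (level-pred E (suc i) (s≤s z≤n))
    where
    cases : (b : Bool) → 2 ≤ (if b then level E (suc i) else suc (level E (suc i))) →
          (2 ≤ level E (suc i) → Σ ℕ λ i' → 1 ≤ i' × i' ≤ suc i × level E i' ≡ pred (level E (suc i))) →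
          Σ ℕ λ i' → 1 ≤ i' × i' ≤ suc (suc i) × level E i' ≡ pred (if b then level E (suc i) else suc (level E (suc i)))
    cases true h ih with ih h
    ... | i' , a , b , c = i' , a , ≤-trans b (n≤1+n _) , c
    cases false h ih = suc i , s≤s z≤n , n≤1+n _ , refl

  level-≡ᵇ : ∀ E i → 1 ≤ i → (level E i ≡ᵇ level E (suc i)) ≡ (i ∈ᵇ E)
  level-≡ᵇ E (suc i) _ with suc i ∈ᵇ E
  ... | true = ≡ᵇ-refl (level E (suc i))
  ... | false = ≢⇒≡ᵇ-false (level E (suc i)) (suc (level E (suc i))) (λ e → <-irrefl e (n<1+n _))

  wordOf : ℕ → List ℕ → List ℕ → List ℕ
  wordOf n τ E = map (λ j → level E (posOf j τ)) (range1 n)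

  length-wordOf : ∀ n τ E → length (wordOf n τ E) ≡ n
  length-wordOf n τ E = trans (length-map _ (range1 n)) (length-range1 n)

  at-wordOf : ∀ n τ E j → 1 ≤ j → j ≤ n → at (wordOf n τ E) j ≡ level E (posOf j τ)
  at-wordOf n τ E j l u = trans (at-map _ (range1 n) j l (subst (j ≤_) (sym (length-range1 n)) u)) (cong (λ x → level E (posOf x τ)) (at-range1 n j l u))

  flatDescents : List ℕ → List ℕ
  flatDescents w = filter (λ i → (at (sortUp w) i ≡ᵇ at (sortUp w) (suc i)) Data.Bool.≟ true) (Des-word (invPerm (σ w)))

  module Encoding (n : ℕ) (w : List ℕ) (wPW : w ∈ PW n) where
    private
      wInfo = PW-∈⁻ n w wPW
    length-w : length w ≡ n
    length-w = proj₁ (proj₁ wInfo)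
    w-packed : isPacked w ≡ true
    w-packed = proj₂ wInfo
    π : List ℕ
    π = σ w
    π-isPerm : IsPerm n π
    π-isPerm = subst (λ m → IsPerm m (σ w)) length-w (σ-isPerm w)
    τ : List ℕ
    τ = invPerm π
    τ-isPerm : IsPerm n τ
    τ-isPerm = InvPermProperties.π⁻¹-isPerm {n} {π} π-isPerm
    open SortedPackedWord w w-packed
    length-s : length s ≡ n
    length-s = trans (↭-length (sortUp-↭ w)) length-w

    indices = interval 1 n

    count-w : ∀ (p : ℕ → Bool) → count p w ≡ count (p ∘ at w) indices
    count-w p = trans (count-at-interval p w) (cong (λ m → count (p ∘ at w) (interval 1 m)) length-w)

    at-π : ∀ j → 1 ≤ j → j ≤ n → at π j ≡ suc (count (aboveᵇ w j) indices)
    at-π j l u = trans (at-σ w j l (subst (j ≤_) (sym length-w) u)) (cong (λ m → suc (count (aboveᵇ w j) (interval 1 m))) length-w)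

    -- σ_w(j) exceeds the number of letters of w below w_j and is at most the number of letters ≤ w_j.
    at-sortUp-π : ∀ j → 1 ≤ j → j ≤ n → at s (at π j) ≡ at w j
    at-sortUp-π j l u = sorted-at s s-sorted x (at π j) lo hi
      where
      x = at w j
      lo : count (_<ᵇ x) s < at π j
      lo = subst₂ _<_ (sym (trans (count-↭ (_<ᵇ x) (sortUp-↭ w)) (count-w (_<ᵇ x)))) (sym (at-π j l u))
             (s≤s (count-mono (λ k → at w k <ᵇ x) (aboveᵇ w j) indices (λ k _ e → cong (_∨ ((j <ᵇ k) ∧ (x ≡ᵇ at w k))) e)))
      disjoint : ∀ k → k ∈ indices → ((at w k <ᵇ x) ∧ (x ≡ᵇ at w k)) ≡ false
      disjoint k _ with at w k <ᵇ x in e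
      ... | false = refl
      ... | true = ≢⇒≡ᵇ-false x (at w k) (λ eq → <-irrefl (sym eq) (<ᵇ-true⇒< e))
      hi : at π j ≤ count (_<ᵇ x) s + count (x ≡ᵇ_) s
      hi = subst₂ _≤_ (sym (at-π j l u))
             (trans (count-or _ _ indices disjoint) (sym (cong₂ _+_ (trans (count-↭ (_<ᵇ x) (sortUp-↭ w)) (count-w (_<ᵇ x)))
                                                          (trans (count-↭ (x ≡ᵇ_) (sortUp-↭ w)) (count-w (x ≡ᵇ_))))))
             (count-strictMono (aboveᵇ w j) (λ k → (at w k <ᵇ x) ∨ (x ≡ᵇ at w k)) indices imp (∈-interval⁺ {1} l (s≤s u)) wit (aboveᵇ-irrefl w j))
        where
        imp : ∀ k → k ∈ indices → aboveᵇ w j k ≡ true → ((at w k <ᵇ x) ∨ (x ≡ᵇ at w k)) ≡ true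
        imp k _ e with aboveᵇ⇒Above w j k e
        ... | inj₁ p rewrite <⇒<ᵇ-true p = refl
        ... | inj₂ (_ , eq) rewrite ≡⇒≡ᵇ-true eq with at w k <ᵇ x
        ...   | true = refl
        ...   | false = refl
        wit : ((at w j <ᵇ x) ∨ (x ≡ᵇ at w j)) ≡ true
        wit rewrite ≥⇒<ᵇ-false {at w j} ≤-refl | ≡ᵇ-refl x = refl

    flat⇒descent : ∀ i → 1 ≤ i → suc i ≤ n → at s i ≡ at s (suc i) → i ∈ Des-word τ
    flat⇒descent i l u eq = ∈Des-word⁺ τ i l (subst (suc i ≤_) (sym (proj₁ τ-isPerm)) u) b<a
      where
      open InvPermProperties {n} {π} π-isPerm
      pa = π∘π⁻¹ i l (≤-trans (n≤1+n i) u)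
      pb = π∘π⁻¹ (suc i) (s≤s z≤n) u
      a = at τ i
      b = at τ (suc i)
      wa : at w a ≡ at s i
      wa = trans (sym (at-sortUp-π a (proj₁ pa) (proj₁ (proj₂ pa)))) (cong (at s) (proj₂ (proj₂ pa)))
      wb : at w b ≡ at s (suc i)
      wb = trans (sym (at-sortUp-π b (proj₁ pb) (proj₁ (proj₂ pb)))) (cong (at s) (proj₂ (proj₂ pb)))
      a≢b : a ≢ b
      a≢b e = <-irrefl (trans (sym (proj₂ (proj₂ pa))) (trans (cong (at π) e) (proj₂ (proj₂ pb)))) (n<1+n i)
      lw' = λ {k} (h : k ≤ n) → subst (k ≤_) (sym length-w) h
      b<a : at τ (suc i) < at τ i
      b<a with Above-total w a b a≢b
      ... | inj₁ bf = ⊥-elim (<-asym (n<1+n i) (subst₂ _<_ (proj₂ (proj₂ pb)) (proj₂ (proj₂ pa))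
              (at-σ-reverses-Above w a b (proj₁ pa) (lw' (proj₁ (proj₂ pa))) (proj₁ pb) (lw' (proj₁ (proj₂ pb))) bf)))
      ... | inj₂ (inj₁ p) = ⊥-elim (<-irrefl (trans wa (trans eq (sym wb))) p)
      ... | inj₂ (inj₂ (p , _)) = p

    E : List ℕ
    E = flatDescents w

    jump⇒∉E : ∀ i → at s (suc i) ≡ suc (at s i) → i ∉ E
    jump⇒∉E i eq m with ∈-filter⁻ (λ i → (at s i ≡ᵇ at s (suc i)) Data.Bool.≟ true) {xs = Des-word τ} m
    ... | _ , e = <-irrefl (trans (≡ᵇ-true⇒≡ _ _ e) eq) (n<1+n _)

    level-step≡sortUp : ∀ i → 1 ≤ i → suc i ≤ n → level E i ≡ at s i → level E (suc i) ≡ at s (suc i)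
    level-step≡sortUp (suc i) _ u ih with step≤1 (suc i) (s≤s z≤n) (subst (suc (suc i) ≤_) (sym length-s) u)
    ... | inj₁ eq rewrite ∈⇒∈ᵇ-true E (∈-filter⁺ (λ i → (at s i ≡ᵇ at s (suc i)) Data.Bool.≟ true)
                            (flat⇒descent (suc i) (s≤s z≤n) u (sym eq)) (≡⇒≡ᵇ-true (sym eq)))
          = trans ih (sym eq)
    ... | inj₂ eq rewrite ∉⇒∈ᵇ-false E (jump⇒∉E (suc i) eq) = trans (cong suc ih) (sym eq)

    level≡sortUp : ∀ i → 1 ≤ i → i ≤ n → level E i ≡ at s i
    level≡sortUp (suc zero) _ u = sym (head≡1 (subst (1 ≤_) (sym length-s) u))
    level≡sortUp (suc (suc i)) _ u = level-step≡sortUp (suc i) (s≤s z≤n) u (level≡sortUp (suc i) (s≤s z≤n) (≤-trans (n≤1+n _) u))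

    wordOf-E : wordOf n τ E ≡ w
    wordOf-E = at-extensionality _ _ (trans (length-wordOf n τ E) (sym length-w)) pointwise
      where
      pointwise : ∀ j → 1 ≤ j → j ≤ length (wordOf n τ E) → at (wordOf n τ E) j ≡ at w j
      pointwise j l u' with subst (j ≤_) (length-wordOf n τ E) u'
      ... | u with proj₁ (proj₂ π-isPerm) j l u
      ... | l2 , u2 = trans (at-wordOf n τ E j l u) (trans (cong (level E) (posOf-invPerm {n} {π} π-isPerm j l u))
                        (trans (level≡sortUp (at π j) l2 u2) (at-sortUp-π j l u)))

    τ∈Perms : τ ∈ Perms n
    τ∈Perms = IsPermProperties.∈Perms {n} {τ} τ-isPerm

    E∈sublists : E ∈ sublists (Des-word τ)
    E∈sublists = filter∈sublists (λ i → at s i ≡ᵇ at s (suc i)) (Des-word τ)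

  module Decoding (n : ℕ) (τ : List ℕ) (τ∈Perms : τ ∈ Perms n) (E : List ℕ) (E∈sublists : E ∈ sublists (Des-word τ)) where
    τ-isPerm : IsPerm n τ
    τ-isPerm = ∈Perms⇒IsPerm n τ τ∈Perms
    open InvPermProperties {n} {τ} τ-isPerm renaming (π⁻¹ to τ⁻¹)
    τ⁻¹-isPerm : IsPerm n τ⁻¹
    τ⁻¹-isPerm = π⁻¹-isPerm
    w : List ℕ
    w = wordOf n τ E
    length-w : length w ≡ n
    length-w = length-wordOf n τ E

    at-w : ∀ j → 1 ≤ j → j ≤ n → at w j ≡ level E (at τ⁻¹ j)
    at-w j l u = trans (at-wordOf n τ E j l u) (cong (level E) (sym (at-π⁻¹ j l u)))

    τ⁻¹-inRange : ∀ j → 1 ≤ j → j ≤ n → InRange n (at τ⁻¹ j)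
    τ⁻¹-inRange j l u = proj₁ (π∘π⁻¹ j l u) , proj₁ (proj₂ (π∘π⁻¹ j l u))

    u' : ∀ {j} → j ≤ length w → j ≤ n
    u' {j} h = subst (j ≤_) length-w h

    w-inRange : All (InRange n) w
    w-inRange = all-at w (λ j l u → subst (InRange n) (sym (at-w j l (u' u)))
      (level-positive E (at τ⁻¹ j) , ≤-trans (level≤ E (at τ⁻¹ j) (proj₁ (τ⁻¹-inRange j l (u' u)))) (proj₂ (τ⁻¹-inRange j l (u' u)))))

    w-packed : isPacked w ≡ true
    w-packed = ∈⇒true⇒all-true _ w pointwise
      where
      pointwise : ∀ y → y ∈ w → (not (y ≡ᵇ 0) ∧ ((y ≡ᵇ 1) ∨ (pred y ∈ᵇ w))) ≡ true
      pointwise y m with ∈-at w m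
      ... | j , l , u , e with at-w j l (u' u)
      ... | wj rewrite sym e | wj with τ⁻¹-inRange j l (u' u)
      ... | li , ui rewrite ≢⇒≡ᵇ-false (level E (at τ⁻¹ j)) 0 (λ z → <-irrefl (sym z) (level-positive E (at τ⁻¹ j))) with level E (at τ⁻¹ j) ≡ᵇ 1 in e1
      ...   | true = refl
      ...   | false with level-pred E (at τ⁻¹ j) li (≥2 (level-positive E (at τ⁻¹ j)) (≡ᵇ-false⇒≢ e1))
        where
        ≥2 : ∀ {m} → 1 ≤ m → m ≢ 1 → 2 ≤ m
        ≥2 {suc zero} _ ne = ⊥-elim (ne refl)
        ≥2 {suc (suc m)} _ _ = s≤s (s≤s z≤n)
      ...     | i' , l' , u'' , e' with proj₁ (proj₂ τ-isPerm) i' l' (≤-trans u'' ui)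
      ...       | lt , ut = ∈⇒∈ᵇ-true w (subst (_∈ w) at-w-pred (at-∈ w (at τ i') lt (subst (_ ≤_) (sym length-w) ut)))
        where
        at-w-pred : at w (at τ i') ≡ pred (level E (at τ⁻¹ j))
        at-w-pred = trans (at-w (at τ i') lt ut) (trans (cong (level E) (π⁻¹∘π i' l' (≤-trans u'' ui))) e')

    w∈PW : w ∈ PW n
    w∈PW = PW-∈⁺ n w (length-w , w-inRange) w-packed

    increasing : ∀ j k → 1 ≤ j → j ≤ n → 1 ≤ k → k ≤ n → at w j < at w k → at τ⁻¹ j < at τ⁻¹ k
    increasing j k lj uj lk uk lt with at τ⁻¹ j <? at τ⁻¹ k
    ... | yes p = p
    ... | no np = ⊥-elim (<⇒≱ (subst₂ _<_ (at-w j lj uj) (at-w k lk uk) lt) (level-mono E _ _ (≮⇒≥ np)))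

    ties : ∀ j k → 1 ≤ j → j ≤ n → 1 ≤ k → k ≤ n → at w j ≡ at w k → j < k → at τ⁻¹ k < at τ⁻¹ j
    ties j k lj uj lk uk eq j<k with <-cmp (at τ⁻¹ k) (at τ⁻¹ j)
    ... | tri< p _ _ = p
    ... | tri≈ _ p _ = ⊥-elim (<-irrefl (trans (sym (proj₂ (proj₂ (π∘π⁻¹ j lj uj)))) (trans (cong (at τ) (sym p)) (proj₂ (proj₂ (π∘π⁻¹ k lk uk))))) j<k)
    ... | tri> _ _ a<b = ⊥-elim (<-asym j<k (subst₂ _<_ (proj₂ (proj₂ (π∘π⁻¹ k lk uk))) (proj₂ (proj₂ (π∘π⁻¹ j lj uj))) desc))
      where
      a = at τ⁻¹ j
      b = at τ⁻¹ k
      la = proj₁ (τ⁻¹-inRange j lj uj)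
      ub = proj₂ (τ⁻¹-inRange k lk uk)
      flat : level E a ≡ level E b
      flat = trans (sym (at-w j lj uj)) (trans eq (at-w k lk uk))
      desc : at τ b < at τ a
      desc = descent-chain τ a b (λ c ac cb → proj₂ (proj₂ (∈Des-word⁻ τ c (sublists-⊆ (Des-word τ) E E∈sublists c
                (∈ᵇ-true⇒∈ E (level-flat⇒∈ E a b (<⇒≤ a<b) flat c (≤-trans la ac) ac cb)))))) a<b

    σ-w : σ w ≡ τ⁻¹
    σ-w = σ-characterisation n w τ⁻¹ length-w τ⁻¹-isPerm (increasing , ties)

    invPerm-σ-w : invPerm (σ w) ≡ τ
    invPerm-σ-w = trans (cong invPerm σ-w) (invPerm-involutive τ-isPerm)

    levels : List ℕ
    levels = map (level E) (interval 1 n)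

    w↭levels : w ↭ levels
    w↭levels = ↭-trans (subst (λ r → map levelAt r ↭ map levelAt τ) (sym (range1≡interval n)) (map⁺ levelAt (↭-sym (IsPermProperties.↭interval {n} {τ} τ-isPerm))))
                 (subst (λ m → map levelAt τ ↭ map (level E) (interval 1 m)) (proj₁ τ-isPerm) (subst (map levelAt τ ↭_) (map-posOf (level E) τ (IsPermProperties.unique {n} {τ} τ-isPerm)) ↭-refl))
      where
      levelAt : ℕ → ℕ
      levelAt j = level E (posOf j τ)

    sortUp-w : sortUp w ≡ levels
    sortUp-w = Sorted-↭⇒≡ (sortUp w) levels (sortUp-sorted w) (Sorted-map-interval (level E) 1 n (level-mono E)) (↭-trans (sortUp-↭ w) w↭levels)

    at-sortUp-w : ∀ i → 1 ≤ i → i ≤ n → at (sortUp w) i ≡ level E i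
    at-sortUp-w i l u = trans (cong (λ r → at r i) sortUp-w)
      (trans (at-map (level E) (interval 1 n) i l (subst (i ≤_) (sym (length-interval 1 n)) u)) (cong (level E) (at-interval-from1 n i l u)))

    flatDescents-w : flatDescents w ≡ E
    flatDescents-w = trans (cong (λ t → filter (λ i → (at (sortUp w) i ≡ᵇ at (sortUp w) (suc i)) Data.Bool.≟ true) (Des-word t)) invPerm-σ-w)
           (trans (filter-cong _ (λ i → i ∈ᵇ E) (Des-word τ) pointwise) (filter-∈ᵇ-sublist (Des-word τ) E (Des-word-unique τ) E∈sublists))
      where
      pointwise : ∀ i → i ∈ Des-word τ → (at (sortUp w) i ≡ᵇ at (sortUp w) (suc i)) ≡ (i ∈ᵇ E)
      pointwise i m with ∈Des-word⁻ τ i m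
      ... | l , u , _ with subst (suc i ≤_) (proj₁ τ-isPerm) u
      ... | u2 rewrite at-sortUp-w i l (≤-trans (n≤1+n i) u2) | at-sortUp-w (suc i) (s≤s z≤n) u2 = level-≡ᵇ E i l

  Marked : ℕ → List (List ℕ × List ℕ)
  Marked n = concatMap (λ τ → map (τ ,_) (sublists (Des-word τ))) (Perms n)

  Marked-∈⁺ : ∀ n τ E → τ ∈ Perms n → E ∈ sublists (Des-word τ) → (τ , E) ∈ Marked n
  Marked-∈⁺ n τ E mτ mE' = ∈-concatMap⁺ (λ τ → map (τ ,_) (sublists (Des-word τ))) {xs = Perms n}
    (Any.map (λ {x} e → subst (λ x → (τ , E) ∈ map (x ,_) (sublists (Des-word x))) e (∈-map⁺ (τ ,_) mE')) mτ)

  Marked-∈⁻ : ∀ n p → p ∈ Marked n → proj₁ p ∈ Perms n × proj₂ p ∈ sublists (Des-word (proj₁ p))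
  Marked-∈⁻ n p m with find (∈-concatMap⁻ (λ τ → map (τ ,_) (sublists (Des-word τ))) {xs = Perms n} m)
  ... | τ , mτ , m2 with ∈-map⁻ (τ ,_) m2
  ... | E , mE' , refl = mτ , mE'

  Marked-unique : ∀ n → Unique (Marked n)
  Marked-unique n = Unique-concatMap (λ τ → map (τ ,_) (sublists (Des-word τ))) (Perms n) (Perms-unique n)
    (λ τ → UP.map⁺ ,-injectiveʳ (sublists-unique (Des-word τ) (Des-word-unique τ)))
    (λ x y z m1 m2 → first-injective x y z m1 m2)
    where
    first-injective : ∀ x y z → z ∈ map (x ,_) (sublists (Des-word x)) → z ∈ map (y ,_) (sublists (Des-word y)) → x ≡ y
    first-injective x y z m1 m2 with ∈-map⁻ (x ,_) m1 | ∈-map⁻ (y ,_) m2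
    ... | _ , _ , refl | _ , _ , e = ,-injectiveˡ e

  encode : List ℕ → List ℕ × List ℕ
  encode w = invPerm (σ w) , flatDescents w

  decode : ℕ → List ℕ × List ℕ → List ℕ
  decode n p = wordOf n (proj₁ p) (proj₂ p)

  decode∘encode : ∀ n w → w ∈ PW n → encode w ∈ Marked n × decode n (encode w) ≡ w
  decode∘encode n w m = Marked-∈⁺ n _ _ τ∈Perms E∈sublists , wordOf-E
    where open Encoding n w m

  encode∘decode : ∀ n p → p ∈ Marked n → decode n p ∈ PW n × encode (decode n p) ≡ p
  encode∘decode n (τ , E) m with Marked-∈⁻ n (τ , E) m
  ... | mτ , mE' = w∈PW , cong₂ _,_ invPerm-σ-w flatDescents-w
    where open Decoding n τ mτ E mE'

module ListAlgebra {c ℓ} (K : CommutativeRing c ℓ) where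

  open Combinatorics
  open import Data.Bool using (Bool; true; false; if_then_else_; _∨_)
  open import Data.Bool.ListAction using (and)
  open import Data.Nat using (ℕ; _≡ᵇ_)
  open import Data.List using (List; []; _∷_; map; filter; length; _++_; concatMap)
  open import Data.List.Properties using (map-++; map-∘)
  open import Data.List.Membership.Propositional using (_∈_)
  open import Data.List.Relation.Binary.Permutation.Propositional using (_↭_; prep; swap)
  import Data.List.Relation.Binary.Permutation.Propositional as Perm
  open import Data.List.Relation.Binary.Permutation.Propositional.Properties using (map⁺)
  open import Data.List.Relation.Unary.All.Properties using (All¬⇒¬Any)
  open import Data.List.Relation.Unary.Any using (here; there)
  open import Data.List.Relation.Unary.AllPairs using (_∷_)
  open import Data.List.Relation.Unary.Unique.Propositional using (Unique)
  open import Data.Product using (_×_; _,_; proj₁; proj₂)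
  open import Relation.Binary.PropositionalEquality as P using (_≡_)
  import Algebra.Properties.CommutativeSemigroup as CommSemigroupProperties

  open CommutativeRing K
  open OverRing K
  open import Relation.Binary.Reasoning.Setoid setoid
  open CommSemigroupProperties *-commutativeSemigroup using () renaming (interchange to *-interchange; x∙yz≈y∙xz to *-leftComm)
  open CommSemigroupProperties +-commutativeSemigroup using () renaming (interchange to +-interchange; x∙yz≈y∙xz to +-leftComm)

  prodK-cong : ∀ {A : Set} (F G : A → Carrier) xs → (∀ x → x ∈ xs → F x ≈ G x) → prodK (map F xs) ≈ prodK (map G xs)
  prodK-cong F G [] h = refl
  prodK-cong F G (x ∷ xs) h = *-cong (h x (here P.refl)) (prodK-cong F G xs (λ y m → h y (there m)))

  prodK-indicator : ∀ bs → prodK (map (λ b → if b then 1# else 0#) bs) ≈ (if and bs then 1# else 0#)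
  prodK-indicator [] = refl
  prodK-indicator (true ∷ bs) = trans (*-identityˡ _) (prodK-indicator bs)
  prodK-indicator (false ∷ bs) = zeroˡ _

  prodK-*-distrib : ∀ {A : Set} (F G : A → Carrier) xs →
    prodK (map F xs) * prodK (map G xs) ≈ prodK (map (λ x → F x * G x) xs)
  prodK-*-distrib F G [] = *-identityˡ 1#
  prodK-*-distrib F G (x ∷ xs) = trans (*-interchange _ _ _ _) (*-cong refl (prodK-*-distrib F G xs))

  prodK-filter : ∀ (F : ℕ → Carrier) (β : ℕ → Bool) xs →
    prodK (map F (filter (λ d → β d Data.Bool.≟ true) xs)) ≈ prodK (map (λ d → if β d then F d else 1#) xs)
  prodK-filter F β [] = refl
  prodK-filter F β (x ∷ xs) with β x
  ... | true = *-cong refl (prodK-filter F β xs)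
  ... | false = sym (trans (*-identityˡ _) (sym (prodK-filter F β xs)))

  prodK-sublist : ∀ (F : ℕ → Carrier) xs E → Unique xs → E ∈ sublists xs →
    prodK (map F E) ≈ prodK (map (λ d → if d ∈ᵇ E then F d else 1#) xs)
  prodK-sublist F xs E u E∈ = begin
      prodK (map F E)
    ≡⟨ P.cong (λ D → prodK (map F D)) (P.sym (filter-∈ᵇ-sublist xs E u E∈)) ⟩
      prodK (map F (filter (λ d → (d ∈ᵇ E) Data.Bool.≟ true) xs))
    ≈⟨ prodK-filter F (_∈ᵇ E) xs ⟩
      prodK (map (λ d → if d ∈ᵇ E then F d else 1#) xs)
    ∎

  prodK-extract : ∀ (F G : ℕ → Carrier) d₀ xs → Unique xs → d₀ ∈ xs → (∀ d → d ∈ xs → d P.≢ d₀ → F d ≈ G d) →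
    prodK (map F xs) ≈ F d₀ * prodK (map (λ d → if d ≡ᵇ d₀ then 1# else G d) xs)
  prodK-extract F G d₀ (x ∷ xs) (x∉xs ∷ u) (here P.refl) h rewrite ≡ᵇ-refl x =
    *-cong refl (trans (prodK-cong F _ xs away) (sym (*-identityˡ _)))
    where
    away : ∀ d → d ∈ xs → F d ≈ (if d ≡ᵇ x then 1# else G d)
    away d m rewrite ≢⇒≡ᵇ-false d x (λ { P.refl → All¬⇒¬Any x∉xs m }) = h d (there m) (λ { P.refl → All¬⇒¬Any x∉xs m })
  prodK-extract F G d₀ (x ∷ xs) (x∉xs ∷ u) (there d₀∈) h
    rewrite ≢⇒≡ᵇ-false x d₀ (λ { P.refl → All¬⇒¬Any x∉xs d₀∈ }) = begin
      F x * prodK (map F xs)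
    ≈⟨ *-cong (h x (here P.refl) x≢d₀) (prodK-extract F G d₀ xs u d₀∈ (λ d m → h d (there m))) ⟩
      G x * (F d₀ * _)
    ≈⟨ *-leftComm _ _ _ ⟩
      F d₀ * (G x * _)
    ∎
    where
    x≢d₀ : x P.≢ d₀
    x≢d₀ P.refl = All¬⇒¬Any x∉xs d₀∈

  sumK-cong : ∀ {A : Set} (F G : A → Carrier) xs → (∀ x → x ∈ xs → F x ≈ G x) → sumK (map F xs) ≈ sumK (map G xs)
  sumK-cong F G [] h = refl
  sumK-cong F G (x ∷ xs) h = +-cong (h x (here P.refl)) (sumK-cong F G xs (λ y m → h y (there m)))

  sumK-*ˡ : ∀ {A : Set} (a : Carrier) (F : A → Carrier) xs → sumK (map (λ x → a * F x) xs) ≈ a * sumK (map F xs)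
  sumK-*ˡ a F [] = sym (zeroʳ a)
  sumK-*ˡ a F (x ∷ xs) = trans (+-cong refl (sumK-*ˡ a F xs)) (sym (distribˡ a _ _))

  sumK-++ : ∀ (xs ys : List Carrier) → sumK (xs ++ ys) ≈ sumK xs + sumK ys
  sumK-++ [] ys = sym (+-identityˡ _)
  sumK-++ (x ∷ xs) ys = trans (+-cong refl (sumK-++ xs ys)) (sym (+-assoc _ _ _))

  sumK-concatMap : ∀ {A B : Set} (F : B → Carrier) (f : A → List B) xs →
    sumK (map F (concatMap f xs)) ≈ sumK (map (λ x → sumK (map F (f x))) xs)
  sumK-concatMap F f [] = refl
  sumK-concatMap F f (x ∷ xs) = trans (reflexive (P.cong sumK (map-++ F (f x) (concatMap f xs))))
    (trans (sumK-++ (map F (f x)) _) (+-cong refl (sumK-concatMap F f xs)))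

  sumK-↭ : ∀ {xs ys : List Carrier} → xs ↭ ys → sumK xs ≈ sumK ys
  sumK-↭ Perm.refl = refl
  sumK-↭ (prep x p) = +-cong refl (sumK-↭ p)
  sumK-↭ (swap x y p) = trans (+-leftComm x y _) (+-cong refl (+-cong refl (sumK-↭ p)))
  sumK-↭ (Perm.trans p q) = trans (sumK-↭ p) (sumK-↭ q)

  sumK-reindex : ∀ {A B : Set} (xs : List A) (ys : List B) (g : A → B) (h : B → A) (F : B → Carrier) →
    Unique xs → Unique ys →
    (∀ x → x ∈ xs → g x ∈ ys × h (g x) ≡ x) → (∀ y → y ∈ ys → h y ∈ xs × g (h y) ≡ y) →
    sumK (map (λ x → F (g x)) xs) ≈ sumK (map F ys)
  sumK-reindex xs ys g h F ux uy hg gh =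
    trans (reflexive (P.cong sumK (map-∘ xs))) (sumK-↭ (map⁺ F (inverseOn⇒map-↭ g h ux uy hg gh)))

  sumK-indicator : ∀ {A : Set} (p : A → Bool) xs X →
    sumK (map (λ s → (if p s then 1# else 0#) * X) xs) ≈ ℕ→K (length (filter (λ s → p s Data.Bool.≟ true) xs)) * X
  sumK-indicator p [] X = sym (zeroˡ X)
  sumK-indicator p (x ∷ xs) X with p x
  ... | true = trans (+-cong refl (sumK-indicator p xs X)) (sym (distribʳ X 1# _))
  ... | false = trans (+-cong (zeroˡ X) (sumK-indicator p xs X)) (+-identityˡ _)

  sumK-sublists : ∀ (A B : ℕ → Carrier) D → Unique D →
    sumK (map (λ E → prodK (map (λ i → if i ∈ᵇ E then A i else B i) D)) (sublists D)) ≈ prodK (map (λ i → A i + B i) D)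
  sumK-sublists A B [] _ = +-identityʳ 1#
  sumK-sublists A B (x ∷ D) (x∉D ∷ uD) = begin
      sumK (map Π (map (x ∷_) (sublists D) ++ sublists D))
    ≈⟨ reflexive (P.cong sumK (map-++ Π (map (x ∷_) (sublists D)) (sublists D))) ⟩
      sumK (map Π (map (x ∷_) (sublists D)) ++ map Π (sublists D))
    ≈⟨ sumK-++ (map Π (map (x ∷_) (sublists D))) (map Π (sublists D)) ⟩
      sumK (map Π (map (x ∷_) (sublists D))) + sumK (map Π (sublists D))
    ≈⟨ +-cong (reflexive (P.cong sumK (P.sym (map-∘ (sublists D))))) refl ⟩
      sumK (map (λ E → Π (x ∷ E)) (sublists D)) + sumK (map Π (sublists D))
    ≈⟨ +-cong (sumK-cong _ _ (sublists D) with-x) (sumK-cong _ _ (sublists D) without-x) ⟩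
      sumK (map (λ E → A x * Π′ E) (sublists D)) + sumK (map (λ E → B x * Π′ E) (sublists D))
    ≈⟨ +-cong (sumK-*ˡ (A x) Π′ (sublists D)) (sumK-*ˡ (B x) Π′ (sublists D)) ⟩
      A x * sumK (map Π′ (sublists D)) + B x * sumK (map Π′ (sublists D))
    ≈⟨ sym (distribʳ _ _ _) ⟩
      (A x + B x) * sumK (map Π′ (sublists D))
    ≈⟨ *-cong refl (sumK-sublists A B D uD) ⟩
      (A x + B x) * prodK (map (λ i → A i + B i) D)
    ∎
    where
    Π : List ℕ → Carrier
    Π E = prodK (map (λ i → if i ∈ᵇ E then A i else B i) (x ∷ D))
    Π′ : List ℕ → Carrier
    Π′ E = prodK (map (λ i → if i ∈ᵇ E then A i else B i) D)
    with-x : ∀ E → E ∈ sublists D → Π (x ∷ E) ≈ A x * Π′ E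
    with-x E _ rewrite ≡ᵇ-refl x = *-cong refl (prodK-cong _ _ D (λ i i∈D →
      reflexive (P.cong (λ b → if b then A i else B i)
        (P.cong (_∨ (i ∈ᵇ E)) (≢⇒≡ᵇ-false i x (λ { P.refl → All¬⇒¬Any x∉D i∈D }))))))
    without-x : ∀ E → E ∈ sublists D → Π E ≈ B x * Π′ E
    without-x E E∈ rewrite ∉⇒∈ᵇ-false E (λ x∈E → All¬⇒¬Any x∉D (sublists-⊆ D E E∈ x x∈E)) = refl

  combination : ∀ {A : Set} → List (Carrier × A) → (A → Carrier) → Carrier
  combination L X = sumK (map (λ p → proj₁ p * X (proj₂ p)) L)

  combination-cong : ∀ {A : Set} (L : List (Carrier × A)) (X Y : A → Carrier) → (∀ a → X a ≈ Y a) →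
    combination L X ≈ combination L Y
  combination-cong [] X Y h = refl
  combination-cong ((c , a) ∷ L) X Y h = +-cong (*-cong refl (h a)) (combination-cong L X Y h)

  combination-linear : ∀ {A : Set} (L : List (Carrier × A)) (X Y Z : A → Carrier) α β →
    (∀ a → X a + β * Y a ≈ α * Z a) → combination L X + β * combination L Y ≈ α * combination L Z
  combination-linear [] X Y Z α β h = trans (+-cong refl (zeroʳ β)) (trans (+-identityˡ _) (sym (zeroʳ α)))
  combination-linear ((c , a) ∷ L) X Y Z α β h = begin
      (c * X a + ΣX) + β * (c * Y a + ΣY)
    ≈⟨ +-cong refl (distribˡ β _ _) ⟩
      (c * X a + ΣX) + (β * (c * Y a) + β * ΣY)
    ≈⟨ +-interchange _ _ _ _ ⟩
      (c * X a + β * (c * Y a)) + (ΣX + β * ΣY)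
    ≈⟨ +-cong (+-cong refl (*-leftComm β c (Y a))) (combination-linear L X Y Z α β h) ⟩
      (c * X a + c * (β * Y a)) + α * ΣZ
    ≈⟨ +-cong (sym (distribˡ c _ _)) refl ⟩
      c * (X a + β * Y a) + α * ΣZ
    ≈⟨ +-cong (*-cong refl (h a)) refl ⟩
      c * (α * Z a) + α * ΣZ
    ≈⟨ +-cong (*-leftComm c α (Z a)) refl ⟩
      α * (c * Z a) + α * ΣZ
    ≈⟨ sym (distribˡ α _ _) ⟩
      α * (c * Z a + ΣZ)
    ∎
    where
    ΣX = combination L X
    ΣY = combination L Y
    ΣZ = combination L Z


module DescentProduct {c ℓ} (K : CommutativeRing c ℓ) (n : ℕ) (q t : ℕ → CommutativeRing.Carrier K) where

  open import Data.List using (List; map)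
  open import Data.Nat using (_∸_)
  open CommutativeRing K
  open OverRing K

  descentProduct : List ℕ → Carrier
  descentProduct D = prodK (map (λ d → q d + t (n ∸ d)) D)

module NablaOfΛ {c ℓ} (K : CommutativeRing c ℓ) (N : ℕ) (q t : ℕ → CommutativeRing.Carrier K) where

  open Combinatorics
  open import Data.Bool using (Bool; true; false; if_then_else_)
  open import Data.Bool.ListAction using (and)
  open import Data.Empty using (⊥-elim)
  open import Data.Nat using (zero; suc; _<_; _∸_; _≡ᵇ_; z≤n; s≤s; _≤?_)
  open import Data.Nat.Properties using (_≟_; ≤-refl; ≤-trans; n≤1+n; ≤∧≢⇒<; ≤-antisym; ≰⇒>; <⇒≱; ≤-pred)
  open import Data.List using (List; []; _∷_; map; filter; length; replicate)
  open import Data.List.Properties using (length-map; map-∘)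
  open import Data.List.Membership.Propositional using (_∈_)
  open import Data.List.Membership.DecPropositional _≟_ using (_∈?_)
  open import Data.Product using (_×_; _,_; proj₁; proj₂)
  open import Data.Sum using (_⊎_; inj₁; inj₂)
  open import Function using (_∘_)
  open import Relation.Nullary using (yes; no)
  open import Relation.Binary.PropositionalEquality as P using (_≡_; _≢_)
  import Algebra.Properties.Group as GroupProperties

  open CommutativeRing K
  open OverRing K
  open Params (suc N) q t
  open ListAlgebra K
  open DescentProduct K (suc N) q t
  open GroupProperties +-group using () renaming (∙-cancelʳ to +-cancelʳ)
  open import Relation.Binary.Reasoning.Setoid setoid

  positions : List ℕ
  positions = interval 1 N

  BoundedBy : ℕ → (ℕ → ℕ) → Set
  BoundedBy k e = ∀ d → d ∈ positions → e d ≤ k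

  BinaryAbove : ℕ → (ℕ → ℕ) → Set
  BinaryAbove m e = ∀ d → d ∈ positions → m < d → e d ≤ 1

  pow : Carrier → ℕ → Carrier
  pow x zero = 1#
  pow x (suc m) = x * pow x m

  zOf : Comp (suc N) → ℕ → Carrier
  zOf I d = z d (proj₁ I)

  z-cases : ∀ I d → zOf I d ≡ q d ⊎ zOf I d ≡ t (suc N ∸ d)
  z-cases I d with d ∈ᵇ Des (proj₁ I)
  ... | true = inj₂ P.refl
  ... | false = inj₁ P.refl

  root-relation : ∀ a b Z W → Z ≡ a ⊎ Z ≡ b → pow Z 2 * W + (a * b) * (pow Z 0 * W) ≈ (a + b) * (pow Z 1 * W)
  root-relation a b Z W Z-root = begin
      (Z * (Z * 1#)) * W + (a * b) * (1# * W)
    ≈⟨ +-cong (*-cong (*-cong refl (*-identityʳ Z)) refl) (*-cong refl (*-identityˡ W)) ⟩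
      (Z * Z) * W + (a * b) * W
    ≈⟨ sym (distribʳ W _ _) ⟩
      (Z * Z + a * b) * W
    ≈⟨ *-cong (quadratic Z-root) refl ⟩
      ((a + b) * Z) * W
    ≈⟨ *-assoc _ _ _ ⟩
      (a + b) * (Z * W)
    ≈⟨ *-cong refl (*-cong (sym (*-identityʳ Z)) refl) ⟩
      (a + b) * ((Z * 1#) * W)
    ∎
    where
    quadratic : Z ≡ a ⊎ Z ≡ b → Z * Z + a * b ≈ (a + b) * Z
    quadratic (inj₁ P.refl) = trans (sym (distribˡ Z Z b)) (*-comm Z (Z + b))
    quadratic (inj₂ P.refl) = trans (+-comm (Z * Z) (a * Z)) (sym (distribʳ Z a Z))

  zMonomial : Comp (suc N) → (ℕ → ℕ) → Carrier
  zMonomial I e = prodK (map (λ d → pow (zOf I d) (e d)) positions)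

  -- Factors of the value of Σ_I c_I ∏_d z_d(I)^(e d) when Λ_n = Σ_I c_I H̃_I and all e d ≤ 2 (larger exponents never occur).
  reducedPow : ℕ → ℕ → Carrier
  reducedPow d zero = 0#
  reducedPow d (suc zero) = 1#
  reducedPow d (suc (suc _)) = q d + t (suc N ∸ d)

  reducedMonomial : (ℕ → ℕ) → Carrier
  reducedMonomial e = prodK (map (λ d → reducedPow d (e d)) positions)

  update : (ℕ → ℕ) → ℕ → ℕ → ℕ → ℕ
  update e d₀ x d = if d ≡ᵇ d₀ then x else e d

  update-same : ∀ e d₀ x → update e d₀ x d₀ ≡ x
  update-same e d₀ x rewrite ≡ᵇ-refl d₀ = P.refl

  update-other : ∀ e d₀ x d → d ≢ d₀ → update e d₀ x d ≡ e d
  update-other e d₀ x d d≢d₀ rewrite ≢⇒≡ᵇ-false d d₀ d≢d₀ = P.refl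

  update-bounded : ∀ {k} e d₀ x → x ≤ k → BoundedBy k e → BoundedBy k (update e d₀ x)
  update-bounded e d₀ x x≤k bounded d d∈ with d ≟ d₀
  ... | yes P.refl rewrite update-same e d₀ x = x≤k
  ... | no d≢d₀ rewrite update-other e d₀ x d d≢d₀ = bounded d d∈

  update-binaryAbove : ∀ m e x → x ≤ 1 → BinaryAbove (suc m) e → BinaryAbove m (update e (suc m) x)
  update-binaryAbove m e x x≤1 above d d∈ m<d with d ≟ suc m
  ... | yes P.refl rewrite update-same e (suc m) x = x≤1
  ... | no d≢ rewrite update-other e (suc m) x d d≢ = above d d∈ (≤∧≢⇒< m<d (d≢ ∘ P.sym))

  binaryAbove-pred : ∀ m e → BinaryAbove (suc m) e → (suc m ∈ positions → e (suc m) ≤ 1) → BinaryAbove m e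
  binaryAbove-pred m e above at-suc-m d d∈ m<d with d ≟ suc m
  ... | yes P.refl = at-suc-m d∈
  ... | no d≢ = above d d∈ (≤∧≢⇒< m<d (d≢ ∘ P.sym))

  isOne : (ℕ → ℕ) → ℕ → Bool
  isOne e d = e d ≡ᵇ 1

  length-map-isOne : ∀ e → length (map (isOne e) positions) ≡ N
  length-map-isOne e = P.trans (length-map (isOne e) positions) (length-interval 1 N)

  compositionOf : (ℕ → ℕ) → Comp (suc N)
  compositionOf e = fromBits (map (isOne e) positions) ,
    fromBits-positive (map (isOne e) positions) , P.trans (sum-fromBits (map (isOne e) positions)) (P.cong suc (length-map-isOne e))

  pow-binary : ∀ Z x → x ≤ 1 → (if x ≡ᵇ 1 then Z else 1#) ≈ pow Z x
  pow-binary Z zero _ = refl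
  pow-binary Z (suc zero) _ = sym (*-identityʳ Z)
  pow-binary Z (suc (suc x)) (s≤s ())

  reducedPow-binary : ∀ d x → x ≤ 1 → (if x ≡ᵇ 1 then 1# else 0#) ≈ reducedPow d x
  reducedPow-binary d zero _ = refl
  reducedPow-binary d (suc zero) _ = refl
  reducedPow-binary d (suc (suc x)) (s≤s ())

  H̃-compositionOf : ∀ e → BoundedBy 1 e → ∀ I → H̃ I (compositionOf e) ≈ zMonomial I e
  H̃-compositionOf e binary I = begin
      prodK (map (zOf I) (Des (fromBits (map (isOne e) positions))))
    ≡⟨ P.cong (λ D → prodK (map (zOf I) D)) (Des-fromBits (isOne e) 1 N (s≤s z≤n)) ⟩
      prodK (map (zOf I) (filter (λ d → isOne e d Data.Bool.≟ true) positions))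
    ≈⟨ prodK-filter (zOf I) (isOne e) positions ⟩
      prodK (map (λ d → if isOne e d then zOf I d else 1#) positions)
    ≈⟨ prodK-cong _ _ positions (λ d d∈ → pow-binary (zOf I d) (e d) (binary d d∈)) ⟩
      zMonomial I e
    ∎

  Λ-compositionOf : ∀ e → BoundedBy 1 e → Λ (suc N) (compositionOf e) ≈ reducedMonomial e
  Λ-compositionOf e binary = begin
      (if replicate (suc N) 1 ==ᴸ fromBits bs then 1# else 0#)
    ≡⟨ P.cong (λ k → if replicate (suc k) 1 ==ᴸ fromBits bs then 1# else 0#) (P.sym (length-map-isOne e)) ⟩
      (if replicate (suc (length bs)) 1 ==ᴸ fromBits bs then 1# else 0#)
    ≡⟨ P.cong (λ b → if b then 1# else 0#) (allOnes-==ᴸ-fromBits bs) ⟩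
      (if and bs then 1# else 0#)
    ≈⟨ sym (prodK-indicator bs) ⟩
      prodK (map (λ b → if b then 1# else 0#) (map (isOne e) positions))
    ≡⟨ P.cong prodK (P.sym (map-∘ positions)) ⟩
      prodK (map (λ d → if isOne e d then 1# else 0#) positions)
    ≈⟨ prodK-cong _ _ positions (λ d d∈ → reducedPow-binary d (e d) (binary d d∈)) ⟩
      reducedMonomial e
    ∎
    where
    bs = map (isOne e) positions

  descentExponents : Comp (suc N) → ℕ → ℕ
  descentExponents J d = suc (if d ∈ᵇ Des (proj₁ J) then 1 else 0)

  descentExponents-bounded : ∀ J → BoundedBy 2 (descentExponents J)
  descentExponents-bounded J d _ with d ∈ᵇ Des (proj₁ J)
  ... | true = ≤-refl
  ... | false = s≤s z≤n

  eig*H̃≈zMonomial : ∀ I J → eig I * H̃ I J ≈ zMonomial I (descentExponents J)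
  eig*H̃≈zMonomial I J = begin
      prodK (map (zOf I) (range1 N)) * prodK (map (zOf I) DJ)
    ≡⟨ P.cong (λ D → prodK (map (zOf I) D) * prodK (map (zOf I) DJ)) (range1≡interval N) ⟩
      prodK (map (zOf I) positions) * prodK (map (zOf I) DJ)
    ≈⟨ *-cong refl (prodK-sublist (zOf I) positions DJ (interval-unique 1 N) (Des∈sublists N (proj₁ J) (proj₂ J))) ⟩
      prodK (map (zOf I) positions) * prodK (map (λ d → if d ∈ᵇ DJ then zOf I d else 1#) positions)
    ≈⟨ prodK-*-distrib _ _ positions ⟩
      prodK (map (λ d → zOf I d * (if d ∈ᵇ DJ then zOf I d else 1#)) positions)
    ≈⟨ prodK-cong _ _ positions (λ d _ → square-or-self (zOf I d) (d ∈ᵇ DJ)) ⟩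
      zMonomial I (descentExponents J)
    ∎
    where
    DJ = Des (proj₁ J)
    square-or-self : ∀ Z b → Z * (if b then Z else 1#) ≈ pow Z (suc (if b then 1 else 0))
    square-or-self Z true = *-cong refl (sym (*-identityʳ Z))
    square-or-self Z false = refl

  descentProduct≈reducedMonomial : ∀ J → descentProduct (Des (proj₁ J)) ≈ reducedMonomial (descentExponents J)
  descentProduct≈reducedMonomial J =
    trans (prodK-sublist _ positions DJ (interval-unique 1 N) (Des∈sublists N (proj₁ J) (proj₂ J)))
          (prodK-cong _ _ positions (λ d _ → reducedPow-descent d (d ∈ᵇ DJ)))
    where
    DJ = Des (proj₁ J)
    reducedPow-descent : ∀ d b → (if b then q d + t (suc N ∸ d) else 1#) ≈ reducedPow d (suc (if b then 1 else 0))
    reducedPow-descent d true = refl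
    reducedPow-descent d false = refl

  module Expansion (L : List (Carrier × Comp (suc N))) (Λ≋L : Λ (suc N) ≋ combH L) where

    spanSum : (ℕ → ℕ) → Carrier
    spanSum e = combination L (λ I → zMonomial I e)

    spanSum-binary : ∀ e → BoundedBy 1 e → spanSum e ≈ reducedMonomial e
    spanSum-binary e binary = begin
        spanSum e
      ≈⟨ combination-cong L _ _ (λ I → sym (H̃-compositionOf e binary I)) ⟩
        combH L (compositionOf e)
      ≈⟨ sym (Λ≋L (compositionOf e)) ⟩
        Λ (suc N) (compositionOf e)
      ≈⟨ Λ-compositionOf e binary ⟩
        reducedMonomial e
      ∎

    module LowerSquare (d₀ : ℕ) (d₀∈ : d₀ ∈ positions) (e : ℕ → ℕ) (e≡2 : e d₀ ≡ 2) where

      a b : Carrier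
      a = q d₀
      b = t (suc N ∸ d₀)

      extract : ∀ (F G : ℕ → Carrier) → (∀ d → d ∈ positions → d ≢ d₀ → F d ≈ G d) →
        prodK (map F positions) ≈ F d₀ * prodK (map (λ d → if d ≡ᵇ d₀ then 1# else G d) positions)
      extract F G = prodK-extract F G d₀ positions (interval-unique 1 N) d₀∈

      zRest : Comp (suc N) → Carrier
      zRest I = prodK (map (λ d → if d ≡ᵇ d₀ then 1# else pow (zOf I d) (e d)) positions)

      zMonomial-update : ∀ I x → zMonomial I (update e d₀ x) ≈ pow (zOf I d₀) x * zRest I
      zMonomial-update I x =
        trans (extract _ _ (λ d _ d≢d₀ → reflexive (P.cong (pow (zOf I d)) (update-other e d₀ x d d≢d₀))))
              (*-cong (reflexive (P.cong (pow (zOf I d₀)) (update-same e d₀ x))) refl)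

      zMonomial-split : ∀ I → zMonomial I e ≈ pow (zOf I d₀) 2 * zRest I
      zMonomial-split I = trans (extract _ _ (λ _ _ _ → refl)) (*-cong (reflexive (P.cong (pow (zOf I d₀)) e≡2)) refl)

      spanSum-recurrence : spanSum e + (a * b) * spanSum (update e d₀ 0) ≈ (a + b) * spanSum (update e d₀ 1)
      spanSum-recurrence = combination-linear L _ _ _ (a + b) (a * b) λ I → begin
          zMonomial I e + (a * b) * zMonomial I (update e d₀ 0)
        ≈⟨ +-cong (zMonomial-split I) (*-cong refl (zMonomial-update I 0)) ⟩
          pow (zOf I d₀) 2 * zRest I + (a * b) * (pow (zOf I d₀) 0 * zRest I)
        ≈⟨ root-relation a b (zOf I d₀) (zRest I) (z-cases I d₀) ⟩
          (a + b) * (pow (zOf I d₀) 1 * zRest I)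
        ≈⟨ *-cong refl (sym (zMonomial-update I 1)) ⟩
          (a + b) * zMonomial I (update e d₀ 1)
        ∎

      reducedRest : Carrier
      reducedRest = prodK (map (λ d → if d ≡ᵇ d₀ then 1# else reducedPow d (e d)) positions)

      reducedMonomial-update : ∀ x → reducedMonomial (update e d₀ x) ≈ reducedPow d₀ x * reducedRest
      reducedMonomial-update x =
        trans (extract _ _ (λ d _ d≢d₀ → reflexive (P.cong (reducedPow d) (update-other e d₀ x d d≢d₀))))
              (*-cong (reflexive (P.cong (reducedPow d₀) (update-same e d₀ x))) refl)

      reducedMonomial-split : reducedMonomial e ≈ (a + b) * reducedRest
      reducedMonomial-split = trans (extract _ _ (λ _ _ _ → refl)) (*-cong (reflexive (P.cong (reducedPow d₀) e≡2)) refl)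

      reducedMonomial-recurrence :
        reducedMonomial e + (a * b) * reducedMonomial (update e d₀ 0) ≈ (a + b) * reducedMonomial (update e d₀ 1)
      reducedMonomial-recurrence = begin
          reducedMonomial e + (a * b) * reducedMonomial (update e d₀ 0)
        ≈⟨ +-cong reducedMonomial-split (*-cong refl (trans (reducedMonomial-update 0) (zeroˡ reducedRest))) ⟩
          (a + b) * reducedRest + (a * b) * 0#
        ≈⟨ trans (+-cong refl (zeroʳ (a * b))) (+-identityʳ _) ⟩
          (a + b) * reducedRest
        ≈⟨ *-cong refl (sym (trans (reducedMonomial-update 1) (*-identityˡ reducedRest))) ⟩
          (a + b) * reducedMonomial (update e d₀ 1)
        ∎

      lowerSquare : spanSum (update e d₀ 0) ≈ reducedMonomial (update e d₀ 0) →
                    spanSum (update e d₀ 1) ≈ reducedMonomial (update e d₀ 1) →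
                    spanSum e ≈ reducedMonomial e
      lowerSquare at0 at1 = +-cancelʳ ((a * b) * reducedMonomial (update e d₀ 0)) (spanSum e) (reducedMonomial e) (begin
          spanSum e + (a * b) * reducedMonomial (update e d₀ 0)
        ≈⟨ +-cong refl (*-cong refl (sym at0)) ⟩
          spanSum e + (a * b) * spanSum (update e d₀ 0)
        ≈⟨ spanSum-recurrence ⟩
          (a + b) * spanSum (update e d₀ 1)
        ≈⟨ *-cong refl at1 ⟩
          (a + b) * reducedMonomial (update e d₀ 1)
        ≈⟨ sym reducedMonomial-recurrence ⟩
          reducedMonomial e + (a * b) * reducedMonomial (update e d₀ 0)
        ∎)

    -- Induction lowering the exponents 2 to 0 or 1, position by position from the top.
    spanSum≈reducedMonomial-above : ∀ m e → BoundedBy 2 e → BinaryAbove m e → spanSum e ≈ reducedMonomial e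
    spanSum≈reducedMonomial-above zero e _ binary = spanSum-binary e (λ d d∈ → binary d d∈ (proj₁ (∈-interval⁻ d∈)))
    spanSum≈reducedMonomial-above (suc m) e bounded above with e (suc m) ≤? 1 | suc m ∈? positions
    ... | yes ≤1 | _ = spanSum≈reducedMonomial-above m e bounded (binaryAbove-pred m e above (λ _ → ≤1))
    ... | no _ | no m+1∉ = spanSum≈reducedMonomial-above m e bounded (binaryAbove-pred m e above (λ m+1∈ → ⊥-elim (m+1∉ m+1∈)))
    ... | no ≰1 | yes m+1∈ =
      LowerSquare.lowerSquare (suc m) m+1∈ e (≤-antisym (bounded (suc m) m+1∈) (≰⇒> ≰1)) (lower 0 z≤n) (lower 1 ≤-refl)
      where
      lower : ∀ x → x ≤ 1 → spanSum (update e (suc m) x) ≈ reducedMonomial (update e (suc m) x)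
      lower x x≤1 = spanSum≈reducedMonomial-above m (update e (suc m) x)
        (update-bounded e (suc m) x (≤-trans x≤1 (n≤1+n 1)) bounded) (update-binaryAbove m e x x≤1 above)

    spanSum≈reducedMonomial : ∀ e → BoundedBy 2 e → spanSum e ≈ reducedMonomial e
    spanSum≈reducedMonomial e bounded = spanSum≈reducedMonomial-above N e bounded
      (λ d d∈ N<d → ⊥-elim (<⇒≱ N<d (≤-pred (proj₂ (∈-interval⁻ d∈)))))

    ∇-coefficient : ∀ J → combination L (λ I → eig I * H̃ I J) ≈ descentProduct (Des (proj₁ J))
    ∇-coefficient J = begin
        combination L (λ I → eig I * H̃ I J)
      ≈⟨ combination-cong L _ _ (λ I → eig*H̃≈zMonomial I J) ⟩
        spanSum (descentExponents J)
      ≈⟨ spanSum≈reducedMonomial (descentExponents J) (descentExponents-bounded J) ⟩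
        reducedMonomial (descentExponents J)
      ≈⟨ sym (descentProduct≈reducedMonomial J) ⟩
        descentProduct (Des (proj₁ J))
      ∎

  ∇-combH : ∀ ∇ → IsNabla ∇ → ∀ L J → ∇ (combH L) J ≈ combination L (λ I → eig I * H̃ I J)
  ∇-combH ∇ ((cong∇ , _ , scale∇) , _) [] J =
    trans (cong∇ _ _ (λ _ → sym (zeroˡ _)) J) (trans (scale∇ 0# (combH []) J) (zeroˡ _))
  ∇-combH ∇ isNabla@((_ , add∇ , scale∇) , eigen∇) ((c , I) ∷ L) J =
    trans (add∇ (c ⊙ H̃ I) (combH L) J)
          (+-cong (trans (scale∇ c (H̃ I) J) (*-cong refl (eigen∇ I J))) (∇-combH ∇ isNabla L J))

  ∇Λ≈descentProduct : HSpans → ∀ ∇ → IsNabla ∇ → ∀ J → ∇ (Λ (suc N)) J ≈ descentProduct (Des (proj₁ J))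
  ∇Λ≈descentProduct spans ∇ isNabla J with spans (Λ (suc N))
  ... | L , Λ≋L = begin
      ∇ (Λ (suc N)) J
    ≈⟨ proj₁ (proj₁ isNabla) _ _ Λ≋L J ⟩
      ∇ (combH L) J
    ≈⟨ ∇-combH ∇ isNabla L J ⟩
      combination L (λ I → eig I * H̃ I J)
    ≈⟨ Expansion.∇-coefficient L Λ≋L J ⟩
      descentProduct (Des (proj₁ J))
    ∎

module PackedWordExpansion {c ℓ} (K : CommutativeRing c ℓ) (N : ℕ) (q t ι : ℕ → CommutativeRing.Carrier K) where

  open Combinatorics
  open import Data.Bool using (Bool; true; false; if_then_else_)
  open import Data.Nat using (suc; _∸_; _≡ᵇ_; z≤n; s≤s)
  open import Data.List using (List; map)
  open import Data.List.Properties using (map-∘)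
  open import Data.List.Membership.Propositional using (_∈_)
  open import Data.Product using (_×_; _,_; proj₁; proj₂)
  open import Relation.Binary.PropositionalEquality as P using (_≡_)

  open CommutativeRing K
  open OverRing K
  open Params (suc N) q t
  open ListAlgebra K
  open DescentProduct K (suc N) q t
  open import Relation.Binary.Reasoning.Setoid setoid

  ι-cancel : (∀ m → ℕ→K (suc m) * ι (suc m) ≈ 1#) → ∀ m → 1 ≤ m → ∀ X → ι m * (ℕ→K m * X) ≈ X
  ι-cancel ι-inverse (suc k) _ X = begin
      ι (suc k) * (ℕ→K (suc k) * X)
    ≈⟨ sym (*-assoc _ _ _) ⟩
      (ι (suc k) * ℕ→K (suc k)) * X
    ≈⟨ *-cong (trans (*-comm _ _) (ι-inverse k)) refl ⟩
      1# * X
    ≈⟨ *-identityˡ X ⟩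
      X
    ∎

  markedWeight : List ℕ → List ℕ → Carrier
  markedWeight τ E = prodK (map (λ i → if i ∈ᵇ E then q i else t (suc N ∸ i)) (Des-word τ))

  φ≈markedWeight : ∀ w → φ w ≈ markedWeight (invPerm (σ w)) (flatDescents w)
  φ≈markedWeight w = prodK-cong _ _ (Des-word (invPerm (σ w))) (λ i i∈ →
    reflexive (P.cong (λ b → if b then q i else t (suc N ∸ i)) (P.sym (∈ᵇ-filter flat (Des-word (invPerm (σ w))) i i∈))))
    where
    flat : ℕ → Bool
    flat i = at (sortUp w) i ≡ᵇ at (sortUp w) (suc i)

  module _ (J : Comp (suc N)) where

    indicator : List ℕ → Carrier
    indicator I = R (suc N) I J

    weight : List ℕ × List ℕ → Carrier
    weight (τ , E) = indicator (C τ) * markedWeight τ E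

    dJ : ℕ
    dJ = dcount (suc N) (proj₁ J)

    RHS-term≈weight∘encode : ∀ w →
      φ w * ι (dcount (suc N) (C (invPerm (σ w)))) * R (suc N) (C (invPerm (σ w))) J ≈ ι dJ * weight (encode w)
    RHS-term≈weight∘encode w with C (invPerm (σ w)) ==ᴸ proj₁ J in e
    ... | true = begin
          φ w * ι (dcount (suc N) (C (invPerm (σ w)))) * 1#
        ≈⟨ *-identityʳ _ ⟩
          φ w * ι (dcount (suc N) (C (invPerm (σ w))))
        ≈⟨ *-cong refl (reflexive (P.cong (λ I → ι (dcount (suc N) I)) (==ᴸ-true⇒≡ _ _ e))) ⟩
          φ w * ι dJ
        ≈⟨ *-comm _ _ ⟩
          ι dJ * φ w
        ≈⟨ *-cong refl (trans (φ≈markedWeight w) (sym (*-identityˡ _))) ⟩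
          ι dJ * (1# * markedWeight (invPerm (σ w)) (flatDescents w))
        ∎
    ... | false = trans (zeroʳ _) (sym (trans (*-cong refl (zeroˡ _)) (zeroʳ _)))

    weight-fibre : ∀ τ → τ ∈ Perms (suc N) →
      sumK (map weight (map (τ ,_) (sublists (Des-word τ)))) ≈ indicator (C τ) * descentProduct (Des (proj₁ J))
    weight-fibre τ τ∈ = begin
        sumK (map weight (map (τ ,_) (sublists (Des-word τ))))
      ≡⟨ P.cong sumK (P.sym (map-∘ (sublists (Des-word τ)))) ⟩
        sumK (map (λ E → indicator (C τ) * markedWeight τ E) (sublists (Des-word τ)))
      ≈⟨ sumK-*ˡ (indicator (C τ)) (markedWeight τ) (sublists (Des-word τ)) ⟩
        indicator (C τ) * sumK (map (markedWeight τ) (sublists (Des-word τ)))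
      ≈⟨ *-cong refl (sumK-sublists q (λ i → t (suc N ∸ i)) (Des-word τ) (Des-word-unique τ)) ⟩
        indicator (C τ) * descentProduct (Des-word τ)
      ≈⟨ on-support ⟩
        indicator (C τ) * descentProduct (Des (proj₁ J))
      ∎
      where
      on-support : indicator (C τ) * descentProduct (Des-word τ) ≈ indicator (C τ) * descentProduct (Des (proj₁ J))
      on-support with C τ ==ᴸ proj₁ J in e
      ... | true = *-cong refl (reflexive (P.cong descentProduct
                     (P.trans (P.sym (Des-C-Perms (suc N) τ τ∈)) (P.cong Des (==ᴸ-true⇒≡ _ _ e)))))
      ... | false = trans (zeroˡ _) (sym (zeroˡ _))

    RHS≈descentProduct : (∀ m → ℕ→K (suc m) * ι (suc m) ≈ 1#) → RHS ι J ≈ descentProduct (Des (proj₁ J))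
    RHS≈descentProduct ι-inverse = begin
        RHS ι J
      ≈⟨ sumK-cong _ _ (PW (suc N)) (λ w _ → RHS-term≈weight∘encode w) ⟩
        sumK (map (λ w → ι dJ * weight (encode w)) (PW (suc N)))
      ≈⟨ sumK-*ˡ (ι dJ) (λ w → weight (encode w)) (PW (suc N)) ⟩
        ι dJ * sumK (map (λ w → weight (encode w)) (PW (suc N)))
      ≈⟨ *-cong refl (sumK-reindex (PW (suc N)) (Marked (suc N)) encode (decode (suc N)) weight
                        (PW-unique (suc N)) (Marked-unique (suc N)) (decode∘encode (suc N)) (encode∘decode (suc N))) ⟩
        ι dJ * sumK (map weight (Marked (suc N)))
      ≈⟨ *-cong refl (sumK-concatMap weight (λ τ → map (τ ,_) (sublists (Des-word τ))) (Perms (suc N))) ⟩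
        ι dJ * sumK (map (λ τ → sumK (map weight (map (τ ,_) (sublists (Des-word τ))))) (Perms (suc N)))
      ≈⟨ *-cong refl (sumK-cong _ _ (Perms (suc N)) weight-fibre) ⟩
        ι dJ * sumK (map (λ τ → indicator (C τ) * descentProduct (Des (proj₁ J))) (Perms (suc N)))
      ≈⟨ *-cong refl (sumK-indicator (λ τ → C τ ==ᴸ proj₁ J) (Perms (suc N)) _) ⟩
        ι dJ * (ℕ→K dJ * descentProduct (Des (proj₁ J)))
      ≈⟨ ι-cancel ι-inverse dJ (dcount-positive (suc N) (proj₁ J) (s≤s z≤n) (proj₂ J)) _ ⟩
        descentProduct (Des (proj₁ J))
      ∎

mainTheorem7 : {c ℓ : Level} (K : CommutativeRing c ℓ) →
    let open CommutativeRing K using (Carrier) in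
    let open OverRing K in
    (ι : ℕ → Carrier) → IsCharZeroField ι →
    (n : ℕ) → 1 ≤ n →
    (q t : ℕ → Carrier) →
    let open Params n q t in
    HSpans →
    (∇ : Sym n → Sym n) → IsNabla ∇ →
    ∇ (Λ n) ≋ RHS ι
mainTheorem7 K ι (_ , _ , ι-inverse) (suc N) _ q t spans ∇ isNabla J = begin
    ∇ (Λ (suc N)) J
  ≈⟨ NablaOfΛ.∇Λ≈descentProduct K N q t spans ∇ isNabla J ⟩
    descentProduct (Des (proj₁ J))
  ≈⟨ sym (PackedWordExpansion.RHS≈descentProduct K N q t ι J ι-inverse) ⟩
    RHS ι J
  ∎
  where
  open CommutativeRing K
  open OverRing K
  open Params (suc N) q t
  open DescentProduct K (suc N) q t
  open import Relation.Binary.Reasoning.Setoid setoid
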